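{- Let $D=(V,E)$ be a weakly connected finite directed graph and $e\in E$. Then $h^*_D=h^*_{D-e}$ if and only if $e$ is a loop of $D$, or $e$ is a bridge of $D$, or there is another edge of $D$ parallel to $e$ (i.e. an edge $f\neq e$ with the same tail and the same head as $e$).
   Context: Directed graphs may have loops and multiple edges. For an edge $e$ with tail $t$ and head $h$, let $\mathbf{x}_e\in\mathbb{R}^V$ be the vector with coordinate $1$ at $h$, $-1$ at $t$, and $0$ elsewhere. The extended root polytope is $\tilde{\mathcal{Q}}_D=\operatorname{conv}(\{\mathbf{0}\}\cup\{\mathbf{x}_e\mid e\in E\})\subset\mathbb{R}^V$. For a $d$-dimensional lattice polytope $Q\subset\mathbb{R}^n$, its $h^*$-polynomial $\sum_{i=0}^d h^*_i t^i$ is defined by $\sum_{i=0}^d h^*_i t^i=(1-t)^{d+1}\sum_{k\ge 0}|(kQ)\cap\mathbb{Z}^n|\,t^k$; $h^*_D$ denotes the $h^*$-polynomial of $\tilde{\mathcal{Q}}_D$ (with respect to the lattice $\mathbb{Z}^V$). $D-e$ is $D$ with $e$ deleted. A bridge is an edge whose removal disconnects the underlying undirected graph (i.e. an edge forming a one-element cut). Weakly connected means the underlying undirected graph is connected. -}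

module Defs where

open import Data.Nat as ℕ using (ℕ; zero; suc)
open import Data.Nat.Combinatorics using (_C_)
open import Data.Integer as ℤ using (ℤ; +_)
open import Data.Rational as ℚ using (ℚ; 0ℚ; 1ℚ; _/_)
open import Data.Fin using (Fin; zero; suc; punchIn; _≟_)
open import Data.Vec using (Vec; lookup)
open import Data.List using (List; length)
open import Data.List.Membership.Propositional using (_∈_)
open import Data.List.Relation.Unary.Unique.Propositional using (Unique)
open import Data.Product using (Σ; ∃; _×_)
open import Data.Sum using (_⊎_)
open import Relation.Nullary using (¬_; yes; no)
open import Relation.Binary.PropositionalEquality using (_≡_; _≢_)
open import Function.Bundles using (_⇔_)

record Digraph (n m : ℕ) : Set where
  field
    tail : Fin m → Fin n
    head : Fin m → Fin n
open Digraph public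

deleteEdge : ∀ {n m} → Digraph n (suc m) → Fin (suc m) → Digraph n m
tail (deleteEdge D e) f = tail D (punchIn e f)
head (deleteEdge D e) f = head D (punchIn e f)

data Reach {n m : ℕ} (D : Digraph n m) : Fin n → Fin n → Set where
  here : ∀ {u} → Reach D u u
  fwd  : ∀ {u} (f : Fin m) → Reach D u (tail D f) → Reach D u (head D f)
  bwd  : ∀ {u} (f : Fin m) → Reach D u (head D f) → Reach D u (tail D f)

WeaklyConnected : ∀ {n m} → Digraph n m → Set
WeaklyConnected D = ∀ u v → Reach D u v

IsLoop : ∀ {n m} → Digraph n m → Fin m → Set
IsLoop D e = tail D e ≡ head D e

IsBridge : ∀ {n m} → Digraph n (suc m) → Fin (suc m) → Set
IsBridge D e = ¬ WeaklyConnected (deleteEdge D e)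

HasParallel : ∀ {n m} → Digraph n m → Fin m → Set
HasParallel {m = m} D e =
  Σ (Fin m) λ f → f ≢ e × tail D f ≡ tail D e × head D f ≡ head D e

sumℚ : ∀ {k} → (Fin k → ℚ) → ℚ
sumℚ {zero} g = 0ℚ
sumℚ {suc k} g = g zero ℚ.+ sumℚ (λ i → g (suc i))

sumℤ : ∀ {k} → (Fin k → ℤ) → ℤ
sumℤ {zero} g = + 0
sumℤ {suc k} g = g zero ℤ.+ sumℤ (λ i → g (suc i))

indicator : ∀ {n} → Fin n → Fin n → ℚ
indicator a v with a ≟ v
... | yes _ = 1ℚ
... | no _ = 0ℚ

xvec : ∀ {n m} → Digraph n m → Fin m → Fin n → ℚ
xvec D e v = indicator (head D e) v ℚ.- indicator (tail D e) v

-- q lies in t · Q̃_D  (t ≥ 0 rational), where Q̃_D = conv({0} ∪ {x_e}):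
-- q = Σ λ_e x_e with λ_e ≥ 0 and Σ λ_e ≤ t.
InDilate : ∀ {n m} → Digraph n m → ℚ → (Fin n → ℚ) → Set
InDilate {n} {m} D t q =
  Σ (Fin m → ℚ) λ lam →
    (∀ f → 0ℚ ℚ.≤ lam f) × (sumℚ lam ℚ.≤ t) ×
    (∀ v → q v ≡ sumℚ (λ f → lam f ℚ.* xvec D f v))

toℚ : ℤ → ℚ
toℚ z = z / 1

LatticeIn : ∀ {n m} → Digraph n m → ℕ → Vec ℤ n → Set
LatticeIn D k p = InDilate D ((+ k) / 1) (λ v → toℚ (lookup p v))

IsEhrhartCount : ∀ {n m} → Digraph n m → (ℕ → ℕ) → Set
IsEhrhartCount {n} D L = ∀ k →
  Σ (List (Vec ℤ n)) λ ps →
    Unique ps × (∀ p → (p ∈ ps) ⇔ LatticeIn D k p) × (length ps ≡ L k)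

LinIndep : ∀ {n j} → (Fin j → Fin n → ℚ) → Set
LinIndep {n} {j} ps = ∀ (c : Fin j → ℚ) →
  (∀ v → sumℚ (λ i → c i ℚ.* ps i v) ≡ 0ℚ) → ∀ i → c i ≡ 0ℚ

-- dim Q̃_D = d : since 0 ∈ Q̃_D its affine hull is its linear span;
-- d = maximal number of linearly independent points of Q̃_D.
IsDim : ∀ {n m} → Digraph n m → ℕ → Set
IsDim {n} D d =
  (Σ (Fin d → Fin n → ℚ) λ ps → (∀ i → InDilate D 1ℚ (ps i)) × LinIndep ps) ×
  (∀ (ps : Fin (suc d) → Fin n → ℚ) → (∀ i → InDilate D 1ℚ (ps i)) → ¬ LinIndep ps)

-- i-th coefficient of (1 - t)^(d+1) Σ_k L(k) t^k
--   = Σ_{j=0}^{i} (-1)^j C(d+1, j) L(i - j)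
hstarCoeff : ℕ → (ℕ → ℕ) → ℕ → ℤ
hstarCoeff d L i = sumℤ {suc i} λ j →
  sign (Data.Fin.toℕ j) ℤ.* (+ ((suc d C Data.Fin.toℕ j) ℕ.* L (i ℕ.∸ Data.Fin.toℕ j)))
  where
  sign : ℕ → ℤ
  sign zero = + 1
  sign (suc k) = ℤ.- sign k

-- Write D∖e for D - e, so that Q̃_{D∖e} ⊆ Q̃_D.  If e is a loop or has a parallel edge, x_e is
-- already a point of Q̃_{D∖e}: the polytopes coincide and so do their h*-polynomials.
-- If e is a bridge, weighting the vertices beyond e by 1 gives a linear functional that
-- vanishes on Q̃_{D∖e} and reads off the (integral) coefficient of x_e.  Hence the lattice
-- points of (k+1)Q̃_D are those of (k+1)Q̃_{D∖e} together with x_e + kQ̃_D, and the dimension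
-- goes up by one: Q̃_D is a lattice pyramid over Q̃_{D∖e}, and multiplying by (1 - t) cancels
-- the extra factor in the h*-polynomial.  Otherwise D∖e is connected, so x_e lies in the span
-- of the remaining edge vectors and the dimension d is unchanged, while x_e is a new lattice
-- point (q ↦ q(head e) - q(tail e) is 2 on x_e but at most 1 on Q̃_{D∖e}); thus
-- h*₁ = L(1) - (d + 1) L(0) changes.
-- Spans and reachability are not decided here, so the arguments using them run in the
-- double-negation monad; this is harmless as their conclusions (≤ on ℕ, = on ℤ) are decidable.

module Submission where

open import Defs
open import Data.Nat as ℕ using (ℕ; zero; suc)
import Data.Nat.Properties as ℕ
import Data.Nat.Coprimality as Coprimality
open import Data.Integer as ℤ using (ℤ)
import Data.Integer.Properties as ℤ
open import Data.Rational as ℚ using (ℚ; mkℚ; 0ℚ; 1ℚ; _+_; _*_; _-_; -_; _≤_)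
import Data.Rational.Properties as ℚ
open import Data.Rational.Solver using (module +-*-Solver)
import Data.Integer.Solver as ℤ-Solver
open import Data.Nat.Combinatorics using (_C_; nCk+nC[k+1]≡[n+1]C[k+1])
open import Data.Fin using (Fin; zero; suc; toℕ; punchIn; punchOut; _≟_)
import Data.Fin.Properties as Fin
open import Data.Vec.Functional using (_∷_; insertAt)
open import Data.Vec.Functional.Properties using (insertAt-lookup; insertAt-punchIn)
open import Data.Product using (Σ; _×_; _,_; proj₁; proj₂)
open import Data.List using (List; length; filter; _++_; map)
open import Data.Vec using (Vec; lookup; tabulate)
import Data.Vec.Properties as Vec
open import Data.List.Properties using (filter-notAll; length-++; length-map)
import Data.List.Relation.Unary.Any as Any
open import Data.List.Membership.Propositional using (_∈_; _∉_)
open import Data.List.Membership.Propositional.Properties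
  using (∈-filter⁺; ∈-filter⁻; ∈-map⁺; ∈-map⁻; ∈-++⁺ˡ; ∈-++⁺ʳ; ∈-++⁻)
open import Data.List.Relation.Binary.Disjoint.Propositional using (Disjoint)
open import Data.List.Membership.Propositional.Properties.WithK using (unique∧set⇒bag)
open import Data.List.Relation.Unary.Unique.Propositional using (Unique)
import Data.List.Relation.Unary.Unique.Propositional.Properties as Unique
open import Data.List.Relation.Binary.BagAndSetEquality using (∼bag⇒↭)
open import Data.List.Relation.Binary.Permutation.Propositional.Properties using (↭-length)
open import Function.Bundles using (_⇔_; mk⇔; Equivalence)
open import Relation.Binary.Definitions using (DecidableEquality)
open import Data.Sum as Sum using (_⊎_; inj₁; inj₂)
open import Data.Empty using (⊥-elim)
open import Function using (_∘_)
open import Relation.Nullary using (¬_; Dec; yes; no)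
open import Relation.Nullary.Negation using (¬¬-Monad)
open import Relation.Nullary.Decidable using (¬?; _×-dec_; ¬¬-excluded-middle; decidable-stable)
open import Effect.Monad using (RawMonad)
open import Level using (0ℓ)
open import Algebra.Properties.Group ℚ.+-0-group using (inverseʳ-unique) renaming (⁻¹-involutive to neg-involutive)
open import Relation.Binary.PropositionalEquality
  using (_≡_; _≢_; refl; sym; trans; cong; cong₂; subst; subst₂; module ≡-Reasoning)


0≤1 : 0ℚ ≤ 1ℚ
0≤1 = ℚ.*≤* (ℤ.+≤+ ℕ.z≤n)

nonNeg+ : ∀ {x y} → 0ℚ ≤ x → 0ℚ ≤ y → 0ℚ ≤ x + y
nonNeg+ 0≤x 0≤y = ℚ.+-mono-≤ 0≤x 0≤y

nonNeg* : ∀ {x y} → 0ℚ ≤ x → 0ℚ ≤ y → 0ℚ ≤ x * y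
nonNeg* {x} {y} 0≤x 0≤y =
  subst (_≤ x * y) (ℚ.*-zeroʳ x) (ℚ.*-monoˡ-≤-nonNeg x {{ℚ.nonNegative 0≤x}} 0≤y)

*-monoˡ-≤ : ∀ {c x y} → 0ℚ ≤ c → x ≤ y → c * x ≤ c * y
*-monoˡ-≤ {c} 0≤c = ℚ.*-monoˡ-≤-nonNeg c {{ℚ.nonNegative 0≤c}}

x≤x+nonNeg : ∀ {x y} → 0ℚ ≤ y → x ≤ x + y
x≤x+nonNeg {x} 0≤y = subst (_≤ x + _) (ℚ.+-identityʳ x) (ℚ.+-monoʳ-≤ x 0≤y)

c≡0⇒c*x+y≡y : ∀ {c} x y → c ≡ 0ℚ → c * x + y ≡ y
c≡0⇒c*x+y≡y x y refl = trans (cong (_+ y) (ℚ.*-zeroˡ x)) (ℚ.+-identityˡ y)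

x-nonNeg≤x : ∀ {x y} → 0ℚ ≤ y → x - y ≤ x
x-nonNeg≤x {x} 0≤y = subst (x - _ ≤_) (ℚ.+-identityʳ x) (ℚ.+-monoʳ-≤ x (ℚ.neg-antimono-≤ 0≤y))

1≰0 : ¬ (1ℚ ≤ 0ℚ)
1≰0 1≤0 with ℚ.drop-*≤* 1≤0
... | ℤ.+≤+ ()

2≰1 : ¬ (1ℚ + 1ℚ ≤ 1ℚ)
2≰1 2≤1 with ℚ.drop-*≤* 2≤1
... | ℤ.+≤+ (ℕ.s≤s ())

≤⇒0≤- : ∀ {x y} → x ≤ y → 0ℚ ≤ y - x
≤⇒0≤- {x} {y} x≤y = subst (_≤ y - x) (ℚ.+-inverseʳ x) (ℚ.+-monoˡ-≤ (- x) x≤y)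

sumℚ-cong : ∀ {k} {f g : Fin k → ℚ} → (∀ i → f i ≡ g i) → sumℚ f ≡ sumℚ g
sumℚ-cong {zero}  f≗g = refl
sumℚ-cong {suc k} f≗g = cong₂ _+_ (f≗g zero) (sumℚ-cong (λ i → f≗g (suc i)))

sumℚ-zero : ∀ {k} {f : Fin k → ℚ} → (∀ i → f i ≡ 0ℚ) → sumℚ f ≡ 0ℚ
sumℚ-zero {zero}  f≗0 = refl
sumℚ-zero {suc k} f≗0 =
  trans (cong₂ _+_ (f≗0 zero) (sumℚ-zero (λ i → f≗0 (suc i)))) (ℚ.+-identityʳ 0ℚ)

sumℚ-+ : ∀ {k} (f g : Fin k → ℚ) → sumℚ (λ i → f i + g i) ≡ sumℚ f + sumℚ g
sumℚ-+ {zero}  f g = refl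
sumℚ-+ {suc k} f g = trans (cong ((f zero + g zero) +_) (sumℚ-+ (λ i → f (suc i)) (λ i → g (suc i))))
  (interchange (f zero) (g zero) _ _)
  where
  open +-*-Solver
  interchange : ∀ a b c d → (a + b) + (c + d) ≡ (a + c) + (b + d)
  interchange = solve 4 (λ a b c d → (a :+ b) :+ (c :+ d) := (a :+ c) :+ (b :+ d)) refl

sumℚ-*ˡ : ∀ {k} c (f : Fin k → ℚ) → sumℚ (λ i → c * f i) ≡ c * sumℚ f
sumℚ-*ˡ {zero}  c f = sym (ℚ.*-zeroʳ c)
sumℚ-*ˡ {suc k} c f =
  trans (cong (c * f zero +_) (sumℚ-*ˡ c (λ i → f (suc i)))) (sym (ℚ.*-distribˡ-+ c _ _))

sumℚ-neg : ∀ {k} (f : Fin k → ℚ) → sumℚ (λ i → - f i) ≡ - sumℚ f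
sumℚ-neg {zero}  f = refl
sumℚ-neg {suc k} f =
  trans (cong (- f zero +_) (sumℚ-neg (λ i → f (suc i)))) (sym (ℚ.neg-distrib-+ (f zero) _))

sumℚ-minus : ∀ {k} (f g : Fin k → ℚ) → sumℚ (λ i → f i - g i) ≡ sumℚ f - sumℚ g
sumℚ-minus f g = trans (sumℚ-+ f (λ i → - g i)) (cong (sumℚ f +_) (sumℚ-neg g))

sumℚ-swap : ∀ {k l} (f : Fin k → Fin l → ℚ) →
  sumℚ (λ i → sumℚ (f i)) ≡ sumℚ (λ j → sumℚ (λ i → f i j))
sumℚ-swap {zero}  f = sym (sumℚ-zero {f = λ j → sumℚ (λ i → f i j)} (λ _ → refl))
sumℚ-swap {suc k} f = trans (cong (sumℚ (f zero) +_) (sumℚ-swap (λ i → f (suc i))))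
  (sym (sumℚ-+ (f zero) (λ j → sumℚ (λ i → f (suc i) j))))

sumℚ-punchIn : ∀ {k} (i : Fin (suc k)) (f : Fin (suc k) → ℚ) →
  sumℚ f ≡ f i + sumℚ (λ j → f (punchIn i j))
sumℚ-punchIn zero    f = refl
sumℚ-punchIn {suc k} (suc i) f =
  trans (cong (f zero +_) (sumℚ-punchIn i (λ j → f (suc j)))) (swap (f zero) (f (suc i)) _)
  where
  open +-*-Solver
  swap : ∀ a b c → a + (b + c) ≡ b + (a + c)
  swap = solve 3 (λ a b c → a :+ (b :+ c) := b :+ (a :+ c)) refl

sumℚ-insertAt : ∀ {k} (f : Fin k → ℚ) (i : Fin (suc k)) x → sumℚ (insertAt f i x) ≡ x + sumℚ f
sumℚ-insertAt f i x = trans (sumℚ-punchIn i (insertAt f i x))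
  (cong₂ _+_ (insertAt-lookup f i x) (sumℚ-cong (insertAt-punchIn f i x)))

sumℚ-nonNeg : ∀ {k} {f : Fin k → ℚ} → (∀ i → 0ℚ ≤ f i) → 0ℚ ≤ sumℚ f
sumℚ-nonNeg {zero}  0≤f = ℚ.≤-refl
sumℚ-nonNeg {suc k} 0≤f = nonNeg+ (0≤f zero) (sumℚ-nonNeg (λ i → 0≤f (suc i)))

term≤sumℚ : ∀ {k} {f : Fin k → ℚ} → (∀ i → 0ℚ ≤ f i) → ∀ i → f i ≤ sumℚ f
term≤sumℚ {suc k} {f} 0≤f i =
  subst (f i ≤_) (sym (sumℚ-punchIn i f)) (x≤x+nonNeg (sumℚ-nonNeg (λ j → 0≤f (punchIn i j))))

sumℚ-mono-≤ : ∀ {k} {f g : Fin k → ℚ} → (∀ i → f i ≤ g i) → sumℚ f ≤ sumℚ g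
sumℚ-mono-≤ {zero}  f≤g = ℚ.≤-refl
sumℚ-mono-≤ {suc k} f≤g = ℚ.+-mono-≤ (f≤g zero) (sumℚ-mono-≤ (λ i → f≤g (suc i)))

indicator-same : ∀ {n} (a : Fin n) → indicator a a ≡ 1ℚ
indicator-same a with a ≟ a
... | yes _  = refl
... | no a≢a = ⊥-elim (a≢a refl)

indicator-other : ∀ {n} {a b : Fin n} → a ≢ b → indicator a b ≡ 0ℚ
indicator-other {a = a} {b} a≢b with a ≟ b
... | yes a≡b = ⊥-elim (a≢b a≡b)
... | no _    = refl

indicator-nonNeg : ∀ {n} (a b : Fin n) → 0ℚ ≤ indicator a b
indicator-nonNeg a b with a ≟ b
... | yes _ = 0≤1
... | no _  = ℚ.≤-refl

sumℚ-indicator : ∀ {k} (a : Fin k) (f : Fin k → ℚ) → sumℚ (λ i → indicator a i * f i) ≡ f a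
sumℚ-indicator {suc k} a f = begin
  sumℚ (λ i → indicator a i * f i)
    ≡⟨ sumℚ-punchIn a (λ i → indicator a i * f i) ⟩
  indicator a a * f a + sumℚ (λ j → indicator a (punchIn a j) * f (punchIn a j))
    ≡⟨ cong₂ _+_ (trans (cong (_* f a) (indicator-same a)) (ℚ.*-identityˡ (f a)))
                 (sumℚ-zero (λ j → trans (cong (_* f (punchIn a j)) (indicator-other (Fin.punchInᵢ≢i a j ∘ sym)))
                                          (ℚ.*-zeroˡ (f (punchIn a j))))) ⟩
  f a + 0ℚ
    ≡⟨ ℚ.+-identityʳ (f a) ⟩
  f a ∎
  where open ≡-Reasoning

toℚ≡mkℚ : ∀ z → toℚ z ≡ mkℚ z 0 (Coprimality.sym (Coprimality.1-coprimeTo _))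
toℚ≡mkℚ z = ℚ.↥p/↧p≡p (mkℚ z 0 _)

toℚ-+ : ∀ a b → toℚ (a ℤ.+ b) ≡ toℚ a + toℚ b
toℚ-+ a b rewrite toℚ≡mkℚ a | toℚ≡mkℚ b =
  cong (λ z → z ℚ./ 1) (sym (cong₂ ℤ._+_ (ℤ.*-identityʳ a) (ℤ.*-identityʳ b)))

toℚ-suc : ∀ k → toℚ (ℤ.+ suc k) ≡ toℚ (ℤ.+ k) + 1ℚ
toℚ-suc k = trans (toℚ-+ (ℤ.+ 1) (ℤ.+ k)) (ℚ.+-comm 1ℚ (toℚ (ℤ.+ k)))

toℚ-* : ∀ a b → toℚ (a ℤ.* b) ≡ toℚ a * toℚ b
toℚ-* a b rewrite toℚ≡mkℚ a | toℚ≡mkℚ b = refl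

toℚ-neg : ∀ z → toℚ (ℤ.- z) ≡ - toℚ z
toℚ-neg (ℤ.+ zero)  = refl
toℚ-neg (ℤ.+ suc _) = refl
toℚ-neg ℤ.-[1+ k ]  = sym (neg-involutive (toℚ (ℤ.+ suc k)))

sumℚ-toℚ : ∀ {k} (f : Fin k → ℤ) → sumℚ (λ i → toℚ (f i)) ≡ toℚ (sumℤ f)
sumℚ-toℚ {zero}  f = refl
sumℚ-toℚ {suc k} f = trans (cong (toℚ (f zero) +_) (sumℚ-toℚ (λ i → f (suc i))))
  (sym (toℚ-+ (f zero) _))

toℚ-mono-≤ : ∀ {a b} → a ℤ.≤ b → toℚ a ≤ toℚ b
toℚ-mono-≤ {a} {b} a≤b rewrite toℚ≡mkℚ a | toℚ≡mkℚ b =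
  ℚ.*≤* (subst₂ ℤ._≤_ (sym (ℤ.*-identityʳ a)) (sym (ℤ.*-identityʳ b)) a≤b)

toℚ-cancel-≤ : ∀ {a b} → toℚ a ≤ toℚ b → a ℤ.≤ b
toℚ-cancel-≤ {a} {b} a≤b rewrite toℚ≡mkℚ a | toℚ≡mkℚ b =
  subst₂ ℤ._≤_ (ℤ.*-identityʳ a) (ℤ.*-identityʳ b) (ℚ.drop-*≤* a≤b)

toℚ-nonNeg⇒0∨≥1 : ∀ z → 0ℚ ≤ toℚ z → toℚ z ≡ 0ℚ ⊎ 1ℚ ≤ toℚ z
toℚ-nonNeg⇒0∨≥1 (ℤ.+ zero)  _   = inj₁ refl
toℚ-nonNeg⇒0∨≥1 (ℤ.+ suc k) _   = inj₂ (toℚ-mono-≤ {ℤ.+ 1} {ℤ.+ suc k} (ℤ.+≤+ (ℕ.s≤s ℕ.z≤n)))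
toℚ-nonNeg⇒0∨≥1 ℤ.-[1+ k ] 0≤z with toℚ-cancel-≤ {ℤ.+ 0} {ℤ.-[1+ k ]} 0≤z
... | ()

-- Linear combinations, spans and linear independence

lincomb : ∀ {n k} → (Fin k → ℚ) → (Fin k → Fin n → ℚ) → Fin n → ℚ
lincomb a w v = sumℚ (λ j → a j * w j v)

InSpan : ∀ {n r} → (Fin r → Fin n → ℚ) → (Fin n → ℚ) → Set
InSpan {r = r} w x = Σ (Fin r → ℚ) λ a → ∀ v → x v ≡ lincomb a w v

lincomb-insertAt : ∀ {n k} (a : Fin k → ℚ) i x (w : Fin (suc k) → Fin n → ℚ) v →
  lincomb (insertAt a i x) w v ≡ x * w i v + lincomb a (λ j → w (punchIn i j)) v
lincomb-insertAt a i x w v = trans (sumℚ-punchIn i (λ j → insertAt a i x j * w j v))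
  (cong₂ _+_ (cong (_* w i v) (insertAt-lookup a i x))
             (sumℚ-cong (λ j → cong (_* w (punchIn i j) v) (insertAt-punchIn a i x j))))

lincomb-axpy : ∀ {n k} c (a b : Fin k → ℚ) (w : Fin k → Fin n → ℚ) v →
  lincomb (λ j → c * a j + b j) w v ≡ c * lincomb a w v + lincomb b w v
lincomb-axpy c a b w v = begin
  sumℚ (λ j → (c * a j + b j) * w j v)
    ≡⟨ sumℚ-cong (λ j → distrib c (a j) (b j) (w j v)) ⟩
  sumℚ (λ j → c * (a j * w j v) + b j * w j v)
    ≡⟨ sumℚ-+ (λ j → c * (a j * w j v)) (λ j → b j * w j v) ⟩
  sumℚ (λ j → c * (a j * w j v)) + lincomb b w v
    ≡⟨ cong (_+ lincomb b w v) (sumℚ-*ˡ c (λ j → a j * w j v)) ⟩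
  c * lincomb a w v + lincomb b w v ∎
  where
  open +-*-Solver
  open ≡-Reasoning
  distrib : ∀ c a b x → (c * a + b) * x ≡ c * (a * x) + b * x
  distrib = solve 4 (λ c a b x → (c :* a :+ b) :* x := c :* (a :* x) :+ b :* x) refl

lincomb-zeroHead : ∀ {n k} (a : Fin (suc k) → ℚ) (w₀ : Fin n → ℚ) (w : Fin k → Fin n → ℚ) v →
  a zero ≡ 0ℚ → lincomb a (w₀ ∷ w) v ≡ lincomb (a ∘ suc) w v
lincomb-zeroHead a w₀ w v = c≡0⇒c*x+y≡y (w₀ v) (lincomb (a ∘ suc) w v)

module _ {n r : ℕ} {w : Fin r → Fin n → ℚ} where

  InSpan-resp : ∀ {x y} → (∀ v → x v ≡ y v) → InSpan w x → InSpan w y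
  InSpan-resp x≗y (a , x≡) = a , λ v → trans (sym (x≗y v)) (x≡ v)

  InSpan-zero : InSpan w (λ _ → 0ℚ)
  InSpan-zero = (λ _ → 0ℚ) , λ v → sym (sumℚ-zero (λ j → ℚ.*-zeroˡ (w j v)))

  InSpan-basis : ∀ j → InSpan w (w j)
  InSpan-basis j = indicator j , λ v → sym (sumℚ-indicator j (λ l → w l v))

  InSpan-axpy : ∀ c {x y} → InSpan w x → InSpan w y → InSpan w (λ v → c * x v + y v)
  InSpan-axpy c (a , x≡) (b , y≡) = (λ j → c * a j + b j) , λ v →
    trans (cong₂ (λ p q → c * p + q) (x≡ v) (y≡ v)) (sym (lincomb-axpy c a b w v))

InSpan-lincomb : ∀ {n r k} {u : Fin r → Fin n → ℚ} {w : Fin k → Fin n → ℚ} →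
  (∀ j → InSpan u (w j)) → ∀ a → InSpan u (lincomb a w)
InSpan-lincomb {k = zero}  w∈ a = InSpan-zero
InSpan-lincomb {k = suc k} w∈ a =
  InSpan-axpy (a zero) (w∈ zero) (InSpan-lincomb (λ j → w∈ (suc j)) (λ j → a (suc j)))

InSpan-trans : ∀ {n r k} {u : Fin r → Fin n → ℚ} {w : Fin k → Fin n → ℚ} →
  (∀ j → InSpan u (w j)) → ∀ {x} → InSpan w x → InSpan u x
InSpan-trans w∈ (a , x≡) = InSpan-resp (λ v → sym (x≡ v)) (InSpan-lincomb w∈ a)

InSpan-tail : ∀ {n r} {w₀ : Fin n → ℚ} {w : Fin r → Fin n → ℚ} {x} →
  ((a , _) : InSpan (w₀ ∷ w) x) → a zero ≡ 0ℚ → InSpan w x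
InSpan-tail {w₀ = w₀} {w} (a , x≡) a₀≡0 = a ∘ suc , λ v → trans (x≡ v) (lincomb-zeroHead a w₀ w v a₀≡0)

LinIndep-tail : ∀ {n k} {v : Fin (suc k) → Fin n → ℚ} → LinIndep v → LinIndep (λ j → v (suc j))
LinIndep-tail {v = v} li c c·v≡0 j =
  li (0ℚ ∷ c) (λ y → trans (lincomb-zeroHead (0ℚ ∷ c) (v zero) (v ∘ suc) y refl) (c·v≡0 y)) (suc j)

LinIndep-shrink : ∀ {n j k} (P : (Fin n → ℚ) → Set) → j ℕ.≤ k → (v : Fin k → Fin n → ℚ) →
  (∀ i → P (v i)) → LinIndep v → Σ (Fin j → Fin n → ℚ) λ u → (∀ i → P (u i)) × LinIndep u
LinIndep-shrink P j≤k v Pv li with ℕ.m≤n⇒m<n∨m≡n j≤k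
... | inj₂ refl = v , Pv , li
LinIndep-shrink {k = suc k} P j≤k v Pv li | inj₁ (ℕ.s≤s j≤k') =
  LinIndep-shrink P j≤k' (λ i → v (suc i)) (λ i → Pv (suc i)) (LinIndep-tail {v = v} li)

LinIndep⇒nonZero : ∀ {n k} {v : Fin k → Fin n → ℚ} → LinIndep v → ∀ i → ¬ (∀ y → v i y ≡ 0ℚ)
LinIndep⇒nonZero {v = v} li i vᵢ≡0 = ℚ.1≢0
  (trans (sym (indicator-same i)) (li (indicator i) (λ y → trans (sumℚ-indicator i (λ l → v l y)) (vᵢ≡0 y)) i))

LinIndep-∷ : ∀ {n k} {x : Fin n → ℚ} {u : Fin k → Fin n → ℚ} →
  ¬ InSpan u x → LinIndep u → LinIndep (x ∷ u)
LinIndep-∷ {x = x} {u} x∉ li c c·xu≡0 with c zero ℚ.≟ 0ℚ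
... | yes c₀≡0 = λ { zero → c₀≡0 ; (suc j) → li (λ j → c (suc j)) tail≡0 j }
  where
  tail≡0 : ∀ y → lincomb (λ j → c (suc j)) u y ≡ 0ℚ
  tail≡0 y = trans (sym (lincomb-zeroHead c x u y c₀≡0)) (c·xu≡0 y)
... | no c₀≢0 = ⊥-elim (x∉ (a , λ y → sym (lincomb-a≡x y)))
  where
  instance _ = ℚ.≢-nonZero c₀≢0
  c₀⁻¹ = ℚ.1/ c zero
  a : Fin _ → ℚ
  a j = - c₀⁻¹ * c (suc j)
  lincomb-a≡x : ∀ y → lincomb a u y ≡ x y
  lincomb-a≡x y = begin
    lincomb a u y                             ≡⟨ sumℚ-cong (λ j → ℚ.*-assoc (- c₀⁻¹) (c (suc j)) (u j y)) ⟩
    sumℚ (λ j → - c₀⁻¹ * (c (suc j) * u j y)) ≡⟨ sumℚ-*ˡ (- c₀⁻¹) (λ j → c (suc j) * u j y) ⟩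
    - c₀⁻¹ * lincomb (λ j → c (suc j)) u y    ≡⟨ cong (- c₀⁻¹ *_) (inverseʳ-unique _ _ (c·xu≡0 y)) ⟩
    - c₀⁻¹ * - (c zero * x y)                 ≡⟨ neg*neg c₀⁻¹ (c zero) (x y) ⟩
    c₀⁻¹ * c zero * x y                       ≡⟨ cong (_* x y) (ℚ.*-inverseˡ (c zero)) ⟩
    1ℚ * x y                                  ≡⟨ ℚ.*-identityˡ (x y) ⟩
    x y                                       ∎
    where
    open +-*-Solver
    open ≡-Reasoning
    neg*neg : ∀ i c x → - i * - (c * x) ≡ i * c * x
    neg*neg = solve 3 (λ i c x → (:- i) :* (:- (c :* x)) := i :* c :* x) refl

LinIndep-elim : ∀ {n k} {v : Fin (suc k) → Fin n → ℚ} → LinIndep v →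
  ∀ i (s : Fin k → ℚ) → LinIndep (λ j y → s j * v i y + v (punchIn i j) y)
LinIndep-elim {v = v} li i s c c·u≡0 j =
  trans (sym (insertAt-punchIn c i σ j)) (li (insertAt c i σ) C·v≡0 (punchIn i j))
  where
  σ = sumℚ (λ j → c j * s j)
  C·v≡0 : ∀ y → lincomb (insertAt c i σ) v y ≡ 0ℚ
  C·v≡0 y = begin
    lincomb (insertAt c i σ) v y                    ≡⟨ lincomb-insertAt c i σ v y ⟩
    σ * v i y + lincomb c (λ j → v (punchIn i j)) y ≡⟨ cong (_+ _) (ℚ.*-comm σ (v i y)) ⟩
    v i y * σ + lincomb c (λ j → v (punchIn i j)) y ≡⟨ cong (_+ _) (sumℚ-*ˡ (v i y) (λ j → c j * s j)) ⟨
    sumℚ (λ j → v i y * (c j * s j)) + lincomb c (λ j → v (punchIn i j)) y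
                                                           ≡⟨ sumℚ-+ _ (λ j → c j * v (punchIn i j) y) ⟨
    sumℚ (λ j → v i y * (c j * s j) + c j * v (punchIn i j) y)
                                                           ≡⟨ sumℚ-cong (λ j → distrib (c j) (s j) (v i y) _) ⟩
    lincomb c (λ j y → s j * v i y + v (punchIn i j) y) y ≡⟨ c·u≡0 y ⟩
    0ℚ                                                    ∎
    where
    open +-*-Solver
    open ≡-Reasoning
    distrib : ∀ c s z u → z * (c * s) + c * u ≡ c * (s * z + u)
    distrib = solve 4 (λ c s z u → z :* (c :* s) :+ c :* u := c :* (s :* z :+ u)) refl

-- One step of Gaussian elimination: pivot on some vᵢ that uses w₀, or drop v₀ if none does.
eliminate : ∀ {n r k} (w₀ : Fin n → ℚ) (w : Fin r → Fin n → ℚ) (v : Fin (suc k) → Fin n → ℚ) →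
  LinIndep v → (∀ i → InSpan (w₀ ∷ w) (v i)) →
  Σ (Fin k → Fin n → ℚ) λ u → LinIndep u × (∀ j → InSpan w (u j))
eliminate w₀ w v li v∈ with Fin.all? (λ i → proj₁ (v∈ i) zero ℚ.≟ 0ℚ)
... | yes w₀-unused = v ∘ suc , LinIndep-tail {v = v} li , λ j → InSpan-tail (v∈ (suc j)) (w₀-unused (suc j))
... | no w₀-used with Fin.¬∀⟶∃¬ _ _ (λ i → proj₁ (v∈ i) zero ℚ.≟ 0ℚ) w₀-used
... | i , aᵢ≢0 = u , LinIndep-elim {v = v} li i s , u∈
  where
  instance _ = ℚ.≢-nonZero aᵢ≢0
  a : Fin _ → ℚ
  a l = proj₁ (v∈ l) zero
  s : Fin _ → ℚ
  s j = - (a (punchIn i j) * ℚ.1/ a i)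
  u : Fin _ → Fin _ → ℚ
  u j y = s j * v i y + v (punchIn i j) y
  cancels : ∀ j → s j * a i + a (punchIn i j) ≡ 0ℚ
  cancels j = begin
    s j * a i + a′                    ≡⟨ regroup a′ (ℚ.1/ a i) (a i) ⟩
    - (a′ * (ℚ.1/ a i * a i)) + a′    ≡⟨ cong (λ z → - (a′ * z) + a′) (ℚ.*-inverseˡ (a i)) ⟩
    - (a′ * 1ℚ) + a′                  ≡⟨ cong (λ z → - z + a′) (ℚ.*-identityʳ a′) ⟩
    - a′ + a′                         ≡⟨ ℚ.+-inverseˡ a′ ⟩
    0ℚ                                ∎
    where
    open +-*-Solver
    open ≡-Reasoning
    a′ = a (punchIn i j)
    regroup : ∀ x y z → - (x * y) * z + x ≡ - (x * (y * z)) + x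
    regroup = solve 3 (λ x y z → (:- (x :* y)) :* z :+ x := (:- (x :* (y :* z))) :+ x) refl
  u∈ : ∀ j → InSpan w (u j)
  u∈ j = InSpan-tail {w₀ = w₀} {w} (InSpan-axpy {w = w₀ ∷ w} (s j) (v∈ i) (v∈ (punchIn i j))) (cancels j)

⟪_,_⟫ : ∀ {n} → (Fin n → ℚ) → (Fin n → ℚ) → ℚ
⟪ w , q ⟫ = sumℚ (λ v → w v * q v)

module _ {n : ℕ} (w : Fin n → ℚ) where

  pairing-resp : ∀ {q q′} → (∀ v → q v ≡ q′ v) → ⟪ w , q ⟫ ≡ ⟪ w , q′ ⟫
  pairing-resp q≗q′ = sumℚ-cong (λ v → cong (w v *_) (q≗q′ v))

  pairing-+ : ∀ x y → ⟪ w , (λ v → x v + y v) ⟫ ≡ ⟪ w , x ⟫ + ⟪ w , y ⟫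
  pairing-+ x y = trans (sumℚ-cong (λ v → ℚ.*-distribˡ-+ (w v) (x v) (y v)))
                        (sumℚ-+ (λ v → w v * x v) (λ v → w v * y v))

  pairing-lincomb : ∀ {k} (a : Fin k → ℚ) u → ⟪ w , lincomb a u ⟫ ≡ sumℚ (λ j → a j * ⟪ w , u j ⟫)
  pairing-lincomb a u = begin
    sumℚ (λ v → w v * sumℚ (λ j → a j * u j v))
      ≡⟨ sumℚ-cong (λ v → sumℚ-*ˡ (w v) (λ j → a j * u j v)) ⟨
    sumℚ (λ v → sumℚ (λ j → w v * (a j * u j v)))
      ≡⟨ sumℚ-swap (λ v j → w v * (a j * u j v)) ⟩
    sumℚ (λ j → sumℚ (λ v → w v * (a j * u j v)))
      ≡⟨ sumℚ-cong (λ j → sumℚ-cong (λ v → swap (w v) (a j) (u j v))) ⟩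
    sumℚ (λ j → sumℚ (λ v → a j * (w v * u j v)))
      ≡⟨ sumℚ-cong (λ j → sumℚ-*ˡ (a j) (λ v → w v * u j v)) ⟩
    sumℚ (λ j → a j * ⟪ w , u j ⟫) ∎
    where
    open ≡-Reasoning
    open +-*-Solver
    swap : ∀ w a u → w * (a * u) ≡ a * (w * u)
    swap = solve 3 (λ w a u → w :* (a :* u) := a :* (w :* u)) refl

  pairing-xvec : ∀ {m} (G : Digraph n m) f → ⟪ w , xvec G f ⟫ ≡ w (head G f) - w (tail G f)
  pairing-xvec G f = begin
    sumℚ (λ v → w v * (indicator (head G f) v - indicator (tail G f) v))
      ≡⟨ sumℚ-cong (λ v → distrib (w v) (indicator (head G f) v) (indicator (tail G f) v)) ⟩
    sumℚ (λ v → indicator (head G f) v * w v - indicator (tail G f) v * w v)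
      ≡⟨ sumℚ-minus (λ v → indicator (head G f) v * w v) (λ v → indicator (tail G f) v * w v) ⟩
    sumℚ (λ v → indicator (head G f) v * w v) - sumℚ (λ v → indicator (tail G f) v * w v)
      ≡⟨ cong₂ _-_ (sumℚ-indicator (head G f) w) (sumℚ-indicator (tail G f) w) ⟩
    w (head G f) - w (tail G f) ∎
    where
    open ≡-Reasoning
    open +-*-Solver
    distrib : ∀ w a b → w * (a - b) ≡ a * w - b * w
    distrib = solve 3 (λ w a b → w :* (a :- b) := a :* w :- b :* w) refl

open RawMonad (¬¬-Monad {0ℓ}) using (return; _>>=_; _<$>_)

-- Steinitz exchange, under ¬¬ because membership in a span is not decided here.
independent-subfamily : ∀ {n r k} (w : Fin r → Fin n → ℚ) (v : Fin k → Fin n → ℚ) →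
  LinIndep v → (∀ i → InSpan w (v i)) → ¬ ¬ (Σ (Fin k → Fin r) λ σ → LinIndep (w ∘ σ))
independent-subfamily {k = zero} w v li v∈ = return ((λ ()) , λ _ _ ())
independent-subfamily {r = zero} {k = suc k} w v li v∈ =
  λ _ → LinIndep⇒nonZero {v = v} li zero (proj₂ (v∈ zero))
independent-subfamily {r = suc r} {k = suc k} w v li v∈ = ¬¬-excluded-middle >>= cases
  where
  cases : Dec (InSpan (w ∘ suc) (w zero)) → ¬ ¬ (Σ (Fin (suc k) → Fin (suc r)) λ σ → LinIndep (w ∘ σ))
  cases (yes w₀∈) = (λ (σ , li-σ) → suc ∘ σ , li-σ) <$>
    independent-subfamily (w ∘ suc) v li (λ i → InSpan-trans all-in-tail (v∈ i))
    where
    all-in-tail : ∀ j → InSpan (w ∘ suc) (w j)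
    all-in-tail zero    = w₀∈
    all-in-tail (suc j) = InSpan-basis j
  cases (no w₀∉) = let (u , li-u , u∈) = eliminate (w zero) (w ∘ suc) v li v∈ in
    (λ (σ , li-σ) → zero ∷ (suc ∘ σ) ,
       LinIndep-∷ (λ w₀∈ → w₀∉ (InSpan-trans (λ j → InSpan-basis (σ j)) w₀∈)) li-σ) <$>
    independent-subfamily (w ∘ suc) u li-u u∈

-- Dilates of the extended root polytope

insertAt-all : ∀ {k} {A : Set} (P : A → Set) (f : Fin k → A) i x →
  P x → (∀ j → P (f j)) → ∀ y → P (insertAt f i x y)
insertAt-all P f i x Px Pf y with i ≟ y
... | yes refl = subst P (sym (insertAt-lookup f i x)) Px
... | no i≢y   = subst P (trans (sym (insertAt-punchIn f i x (punchOut i≢y)))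
                                (cong (insertAt f i x) (Fin.punchIn-punchOut i≢y))) (Pf _)

module _ {n m : ℕ} (G : Digraph n m) where

  InDilate-resp : ∀ {t q q′} → (∀ v → q v ≡ q′ v) → InDilate G t q → InDilate G t q′
  InDilate-resp q≗q′ (μ , 0≤μ , Σμ≤t , q≡) = μ , 0≤μ , Σμ≤t , λ v → trans (sym (q≗q′ v)) (q≡ v)

  InDilate-zero : ∀ {t} → 0ℚ ≤ t → InDilate G t (λ _ → 0ℚ)
  InDilate-zero 0≤t =
    (λ _ → 0ℚ) , (λ _ → ℚ.≤-refl) , subst (_≤ _) (sym (sumℚ-zero {m} (λ _ → refl))) 0≤t ,
    λ v → sym (sumℚ-zero (λ f → ℚ.*-zeroˡ (xvec G f v)))

  InDilate-edge : ∀ f → InDilate G 1ℚ (xvec G f)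
  InDilate-edge f = indicator f , indicator-nonNeg f , ℚ.≤-reflexive (sumℚ-indicator-1 f) ,
    λ v → sym (sumℚ-indicator f (λ g → xvec G g v))
    where
    sumℚ-indicator-1 : ∀ f → sumℚ (indicator f) ≡ 1ℚ
    sumℚ-indicator-1 f = trans (sumℚ-cong (λ g → sym (ℚ.*-identityʳ (indicator f g))))
                               (sumℚ-indicator f (λ _ → 1ℚ))

  InDilate⇒InSpan : ∀ {t q} → InDilate G t q → InSpan (xvec G) q
  InDilate⇒InSpan (μ , _ , _ , q≡) = μ , q≡

Redundant : ∀ {n m} → Digraph n (suc m) → Fin (suc m) → Set
Redundant D e = InDilate (deleteEdge D e) 1ℚ (xvec D e)

module _ {n m : ℕ} (D : Digraph n (suc m)) (e : Fin (suc m)) where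

  private
    D∖e = deleteEdge D e

  lincomb-deleteEdge : ∀ (μ : Fin (suc m) → ℚ) v →
    lincomb μ (xvec D) v ≡ μ e * xvec D e v + lincomb (μ ∘ punchIn e) (xvec D∖e) v
  lincomb-deleteEdge μ v = sumℚ-punchIn e (λ f → μ f * xvec D f v)

  InDilate-deleteEdge : ∀ {t q} → InDilate D∖e t q → InDilate D t q
  InDilate-deleteEdge {t} (μ , 0≤μ , Σμ≤t , q≡) =
    insertAt μ e 0ℚ , insertAt-all (0ℚ ≤_) μ e 0ℚ ℚ.≤-refl 0≤μ ,
    subst (_≤ t) (sym (trans (sumℚ-insertAt μ e 0ℚ) (ℚ.+-identityˡ _))) Σμ≤t ,
    λ v → trans (q≡ v) (sym (trans (lincomb-insertAt μ e 0ℚ (xvec D) v)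
                                    (c≡0⇒c*x+y≡y (xvec D e v) (lincomb μ (xvec D∖e) v) refl)))

  InDilate-unused : ∀ {t q} ((μ , _) : InDilate D t q) → μ e ≡ 0ℚ → InDilate D∖e t q
  InDilate-unused {t} (μ , 0≤μ , Σμ≤t , q≡) μₑ≡0 =
    μ ∘ punchIn e , 0≤μ ∘ punchIn e ,
    subst (_≤ t) (trans (sumℚ-punchIn e μ)
                        (trans (cong (_+ sumℚ (μ ∘ punchIn e)) μₑ≡0) (ℚ.+-identityˡ _))) Σμ≤t ,
    λ v → trans (q≡ v) (trans (lincomb-deleteEdge μ v)
                              (c≡0⇒c*x+y≡y (xvec D e v) (lincomb (μ ∘ punchIn e) (xvec D∖e) v) μₑ≡0))

  -- Substitute x_e = Σ νg x_g into q = μₑ x_e + Σ μg x_g.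
  InDilate-redundant : Redundant D e → ∀ {t q} → InDilate D t q → InDilate D∖e t q
  InDilate-redundant (ν , 0≤ν , Σν≤1 , xₑ≡) {t} {q} (μ , 0≤μ , Σμ≤t , q≡) =
    μ′ , (λ g → nonNeg+ (nonNeg* (0≤μ e) (0≤ν g)) (0≤μ (punchIn e g))) , Σμ′≤t ,
    λ v → trans (q≡ v) (trans (lincomb-deleteEdge μ v)
                              (trans (cong (λ x → μ e * x + lincomb (μ ∘ punchIn e) (xvec D∖e) v) (xₑ≡ v))
                                     (sym (lincomb-axpy (μ e) ν (μ ∘ punchIn e) (xvec D∖e) v))))
    where
    μ′ : Fin m → ℚ
    μ′ g = μ e * ν g + μ (punchIn e g)
    Σμ′≤t : sumℚ μ′ ≤ t
    Σμ′≤t = begin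
      sumℚ μ′                       ≡⟨ sumℚ-+ (λ g → μ e * ν g) (μ ∘ punchIn e) ⟩
      sumℚ (λ g → μ e * ν g) + rest ≡⟨ cong (_+ rest) (sumℚ-*ˡ (μ e) ν) ⟩
      μ e * sumℚ ν + rest           ≤⟨ ℚ.+-monoˡ-≤ rest (*-monoˡ-≤ (0≤μ e) Σν≤1) ⟩
      μ e * 1ℚ + rest               ≡⟨ cong (_+ rest) (ℚ.*-identityʳ (μ e)) ⟩
      μ e + rest                    ≡⟨ sumℚ-punchIn e μ ⟨
      sumℚ μ                        ≤⟨ Σμ≤t ⟩
      t                             ∎
      where
      open ℚ.≤-Reasoning
      rest = sumℚ (μ ∘ punchIn e)

  InDilate⇒InSpan-deleteEdge : ∀ {t q} → InDilate D t q → InSpan (xvec D e ∷ xvec D∖e) q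
  InDilate⇒InSpan-deleteEdge (μ , _ , _ , q≡) =
    μ e ∷ (μ ∘ punchIn e) , λ v → trans (q≡ v) (lincomb-deleteEdge μ v)

  InDilate-shift : ∀ {t q} ((μ , _) : InDilate D t q) c → 0ℚ ≤ μ e + c →
    InDilate D (t + c) (λ v → q v + c * xvec D e v)
  InDilate-shift {t} {q} (μ , 0≤μ , Σμ≤t , q≡) c 0≤μₑ+c =
    insertAt (μ ∘ punchIn e) e (μ e + c) ,
    insertAt-all (0ℚ ≤_) (μ ∘ punchIn e) e _ 0≤μₑ+c (0≤μ ∘ punchIn e) ,
    subst (_≤ t + c) (sym Σμ′≡) (ℚ.+-monoˡ-≤ c Σμ≤t) ,
    λ v → begin
      q v + c * xvec D e v                       ≡⟨ cong (_+ c * xvec D e v) (trans (q≡ v) (lincomb-deleteEdge μ v)) ⟩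
      μ e * xvec D e v + rest v + c * xvec D e v ≡⟨ regroup (μ e) c (xvec D e v) (rest v) ⟩
      (μ e + c) * xvec D e v + rest v            ≡⟨ lincomb-insertAt (μ ∘ punchIn e) e (μ e + c) (xvec D) v ⟨
      lincomb (insertAt (μ ∘ punchIn e) e (μ e + c)) (xvec D) v ∎
    where
    open ≡-Reasoning
    open +-*-Solver
    rest : Fin n → ℚ
    rest = lincomb (μ ∘ punchIn e) (xvec D∖e)
    regroup : ∀ a c x r → a * x + r + c * x ≡ (a + c) * x + r
    regroup = solve 4 (λ a c x r → a :* x :+ r :+ c :* x := (a :+ c) :* x :+ r) refl
    Σμ′≡ : sumℚ (insertAt (μ ∘ punchIn e) e (μ e + c)) ≡ sumℚ μ + c
    Σμ′≡ = begin
      sumℚ (insertAt (μ ∘ punchIn e) e (μ e + c)) ≡⟨ sumℚ-insertAt (μ ∘ punchIn e) e (μ e + c) ⟩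
      μ e + c + sumℚ (μ ∘ punchIn e)              ≡⟨ swap (μ e) c (sumℚ (μ ∘ punchIn e)) ⟩
      μ e + sumℚ (μ ∘ punchIn e) + c              ≡⟨ cong (_+ c) (sumℚ-punchIn e μ) ⟨
      sumℚ μ + c                                  ∎
      where
      swap : ∀ a c r → a + c + r ≡ a + r + c
      swap = solve 3 (λ a c r → a :+ c :+ r := a :+ r :+ c) refl

  loop⇒redundant : IsLoop D e → Redundant D e
  loop⇒redundant tₑ≡hₑ = InDilate-resp D∖e xₑ≡0 (InDilate-zero D∖e 0≤1)
    where
    xₑ≡0 : ∀ v → 0ℚ ≡ xvec D e v
    xₑ≡0 v = sym (trans (cong (λ u → indicator (head D e) v - indicator u v) tₑ≡hₑ)
                        (ℚ.+-inverseʳ (indicator (head D e) v)))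

  parallel⇒redundant : HasParallel D e → Redundant D e
  parallel⇒redundant (f , f≢e , t≡ , h≡) = InDilate-resp D∖e xf≡xₑ (InDilate-edge D∖e f′)
    where
    f′ = punchOut (f≢e ∘ sym)
    xf≡xₑ : ∀ v → xvec D∖e f′ v ≡ xvec D e v
    xf≡xₑ v rewrite Fin.punchIn-punchOut (f≢e ∘ sym) | t≡ | h≡ = refl

module _ {n m : ℕ} {G : Digraph n m} where

  Reach-trans : ∀ {u v w} → Reach G u v → Reach G v w → Reach G u w
  Reach-trans r here      = r
  Reach-trans r (fwd f s) = fwd f (Reach-trans r s)
  Reach-trans r (bwd f s) = bwd f (Reach-trans r s)

  Reach-sym : ∀ {u v} → Reach G u v → Reach G v u
  Reach-sym here      = here
  Reach-sym (fwd f r) = Reach-trans (bwd f here) (Reach-sym r)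
  Reach-sym (bwd f r) = Reach-trans (fwd f here) (Reach-sym r)

  Reach⇒InSpan : ∀ {u w} → Reach G u w → InSpan (xvec G) (λ v → indicator w v - indicator u v)
  Reach⇒InSpan {u} here = InSpan-resp (λ v → sym (ℚ.+-inverseʳ (indicator u v))) InSpan-zero
  Reach⇒InSpan {u} (fwd f r) =
    InSpan-resp (λ v → telescope (indicator (head G f) v) (indicator (tail G f) v) (indicator u v))
                (InSpan-axpy 1ℚ (InSpan-basis f) (Reach⇒InSpan r))
    where
    open +-*-Solver
    telescope : ∀ h t u → 1ℚ * (h - t) + (t - u) ≡ h - u
    telescope = solve 3 (λ h t u → con 1ℚ :* (h :- t) :+ (t :- u) := h :- u) refl
  Reach⇒InSpan {u} (bwd f r) =
    InSpan-resp (λ v → telescope (indicator (head G f) v) (indicator (tail G f) v) (indicator u v))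
                (InSpan-axpy (- 1ℚ) (InSpan-basis f) (Reach⇒InSpan r))
    where
    open +-*-Solver
    telescope : ∀ h t u → - 1ℚ * (h - t) + (h - u) ≡ t - u
    telescope = solve 3 (λ h t u → :- con 1ℚ :* (h :- t) :+ (h :- u) := t :- u) refl

bridge⇒separates : ∀ {n m} (D : Digraph n (suc m)) e → WeaklyConnected D → IsBridge D e →
  ¬ Reach (deleteEdge D e) (tail D e) (head D e)
bridge⇒separates D e connected bridge tₑ⇝hₑ = bridge (λ u v → reroute (connected u v))
  where
  D∖e = deleteEdge D e
  step : ∀ f → Reach D∖e (tail D f) (head D f)
  step f with e ≟ f
  ... | yes refl = tₑ⇝hₑ
  ... | no e≢f   = subst₂ (Reach D∖e) (cong (tail D) (Fin.punchIn-punchOut e≢f))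
                                      (cong (head D) (Fin.punchIn-punchOut e≢f))
                                      (fwd (punchOut e≢f) here)
  reroute : ∀ {u v} → Reach D u v → Reach D∖e u v
  reroute here      = here
  reroute (fwd f r) = Reach-trans (reroute r) (step f)
  reroute (bwd f r) = Reach-trans (reroute r) (Reach-sym (step f))

module _ {n m d : ℕ} {G : Digraph n m} (dim : IsDim G d) where

  IsDim-bound : ∀ {k} (ps : Fin k → Fin n → ℚ) → (∀ i → InDilate G 1ℚ (ps i)) → LinIndep ps → k ℕ.≤ d
  IsDim-bound {k} ps ps∈ li with k ℕ.≤? d
  ... | yes k≤d = k≤d
  ... | no k≰d  = let (qs , qs∈ , li-qs) = LinIndep-shrink (InDilate G 1ℚ) (ℕ.≰⇒> k≰d) ps ps∈ li
                  in ⊥-elim (proj₂ dim qs qs∈ li-qs)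

  IsDim-bound-InSpan : ∀ {k} (ps : Fin k → Fin n → ℚ) → (∀ i → InSpan (xvec G) (ps i)) → LinIndep ps →
    k ℕ.≤ d
  IsDim-bound-InSpan {k} ps ps∈ li = decidable-stable (k ℕ.≤? d)
    ((λ (σ , li-σ) → IsDim-bound (xvec G ∘ σ) (InDilate-edge G ∘ σ) li-σ) <$>
     independent-subfamily (xvec G) ps li ps∈)

IsDim-mono : ∀ {n m m′ d d′} {G : Digraph n m} {G′ : Digraph n m′} → IsDim G d → IsDim G′ d′ →
  (∀ {q} → InDilate G 1ℚ q → InDilate G′ 1ℚ q) → d ℕ.≤ d′
IsDim-mono {G′ = G′} ((ps , ps∈ , li) , _) dim′ G⊆G′ =
  IsDim-bound {G = G′} dim′ ps (λ i → G⊆G′ (ps∈ i)) li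

-- Counting lattice points

module _ {A : Set} where

  Unique-length-≡ : {xs ys : List A} → Unique xs → Unique ys → (∀ {x} → x ∈ xs ⇔ x ∈ ys) →
    length xs ≡ length ys
  Unique-length-≡ u u′ xs≈ys = ↭-length (∼bag⇒↭ (unique∧set⇒bag u u′ xs≈ys))

  Unique-length-< : DecidableEquality A → {xs ys : List A} {y : A} → Unique xs → Unique ys →
    (∀ {x} → x ∈ xs → x ∈ ys) → y ∈ ys → y ∉ xs → length xs ℕ.< length ys
  Unique-length-< _≟ᴬ_ {xs} {ys} u u′ xs⊆ys y∈ys y∉xs =
    subst (ℕ._< length ys) (sym (Unique-length-≡ u (Unique.filter⁺ (_∈? xs) {ys} u′) xs≈ys∩xs))
          (filter-notAll (_∈? xs) ys (Any.map (λ { refl → y∉xs }) y∈ys))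
    where
    open import Data.List.Membership.DecPropositional _≟ᴬ_ using (_∈?_)
    xs≈ys∩xs : ∀ {x} → x ∈ xs ⇔ x ∈ filter (_∈? xs) ys
    xs≈ys∩xs = mk⇔ (λ x∈ → ∈-filter⁺ (_∈? xs) (xs⊆ys x∈) x∈)
                   (λ x∈ → proj₂ (∈-filter⁻ (_∈? xs) {xs = ys} x∈))

module _ {n m m′ : ℕ} {G : Digraph n m} {G′ : Digraph n m′} {L L′ : ℕ → ℕ}
         (count : IsEhrhartCount G L) (count′ : IsEhrhartCount G′ L′) where

  EhrhartCount-≡ : ∀ k → (∀ p → LatticeIn G k p ⇔ LatticeIn G′ k p) → L k ≡ L′ k
  EhrhartCount-≡ k same with count k | count′ k
  ... | ps , u , ∈ps , |ps|≡ | ps′ , u′ , ∈ps′ , |ps′|≡ =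
    trans (sym |ps|≡) (trans (Unique-length-≡ u u′ (mk⇔ ps⊆ps′ ps′⊆ps)) |ps′|≡)
    where
    open Equivalence
    ps⊆ps′ : ∀ {p} → p ∈ ps → p ∈ ps′
    ps⊆ps′ {p} p∈ = from (∈ps′ p) (to (same p) (to (∈ps p) p∈))
    ps′⊆ps : ∀ {p} → p ∈ ps′ → p ∈ ps
    ps′⊆ps {p} p∈ = from (∈ps p) (from (same p) (to (∈ps′ p) p∈))

  EhrhartCount-< : ∀ k {p₀} → (∀ {p} → LatticeIn G k p → LatticeIn G′ k p) →
    LatticeIn G′ k p₀ → ¬ LatticeIn G k p₀ → L k ℕ.< L′ k
  EhrhartCount-< k {p₀} G⊆G′ p₀∈ p₀∉ with count k | count′ k
  ... | ps , u , ∈ps , |ps|≡ | ps′ , u′ , ∈ps′ , |ps′|≡ = subst₂ ℕ._<_ |ps|≡ |ps′|≡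
    (Unique-length-< (Vec.≡-dec ℤ._≟_) u u′ (λ {p} p∈ → from (∈ps′ p) (G⊆G′ {p} (to (∈ps p) p∈)))
                     (from (∈ps′ p₀) p₀∈) (p₀∉ ∘ to (∈ps p₀)))
    where open Equivalence

-- h*-coefficients

sumℤ-cong : ∀ {k} {f g : Fin k → ℤ} → (∀ i → f i ≡ g i) → sumℤ f ≡ sumℤ g
sumℤ-cong {zero}  f≗g = refl
sumℤ-cong {suc k} f≗g = cong₂ ℤ._+_ (f≗g zero) (sumℤ-cong (λ i → f≗g (suc i)))

sumℤ-zero : ∀ {k} {f : Fin k → ℤ} → (∀ i → f i ≡ ℤ.+ 0) → sumℤ f ≡ ℤ.+ 0
sumℤ-zero {zero}  f≗0 = refl
sumℤ-zero {suc k} f≗0 = cong₂ ℤ._+_ (f≗0 zero) (sumℤ-zero (λ i → f≗0 (suc i)))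

sumℤ-minus : ∀ {k} (f g : Fin k → ℤ) → sumℤ (λ i → f i ℤ.- g i) ≡ sumℤ f ℤ.- sumℤ g
sumℤ-minus {zero}  f g = refl
sumℤ-minus {suc k} f g =
  trans (cong (λ s → (f zero ℤ.- g zero) ℤ.+ s) (sumℤ-minus (λ i → f (suc i)) (λ i → g (suc i))))
        (interchange (f zero) (g zero) _ _)
  where
  open ℤ-Solver.+-*-Solver
  interchange : ∀ a b c d → (a ℤ.- b) ℤ.+ (c ℤ.- d) ≡ (a ℤ.+ c) ℤ.- (b ℤ.+ d)
  interchange = solve 4 (λ a b c d → (a :- b) :+ (c :- d) := (a :+ c) :- (b :+ d)) refl

sgn : ℕ → ℤ
sgn zero    = ℤ.+ 1
sgn (suc k) = ℤ.- sgn k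

-- The i-th coefficient of (1 - t)^a · Σₖ F(k) tᵏ.
mul[1-t]^ : ℕ → (ℕ → ℤ) → ℕ → ℤ
mul[1-t]^ a F i = sumℤ {suc i} λ j → sgn (toℕ j) ℤ.* (ℤ.+ (a C toℕ j) ℤ.* F (i ℕ.∸ toℕ j))

-- Multiplication by 1 - t.
Δ : (ℕ → ℤ) → ℕ → ℤ
Δ F zero    = F zero
Δ F (suc i) = F (suc i) ℤ.- F i

Δ-cong : ∀ {F G} → (∀ k → F k ≡ G k) → ∀ i → Δ F i ≡ Δ G i
Δ-cong F≗G zero    = F≗G zero
Δ-cong F≗G (suc i) = cong₂ ℤ._-_ (F≗G (suc i)) (F≗G i)

mul[1-t]^-cong : ∀ a {F G} → (∀ k → F k ≡ G k) → ∀ i → mul[1-t]^ a F i ≡ mul[1-t]^ a G i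
mul[1-t]^-cong a F≗G i = sumℤ-cong {suc i} λ j →
  cong (λ x → sgn (toℕ j) ℤ.* (ℤ.+ (a C toℕ j) ℤ.* x)) (F≗G (i ℕ.∸ toℕ j))

mul[1-t]^-zero : ∀ F i → mul[1-t]^ 0 F i ≡ F i
mul[1-t]^-zero F i =
  trans (cong₂ ℤ._+_ (trans (ℤ.*-identityˡ _) (ℤ.*-identityˡ (F i))) (sumℤ-zero {i} {f = later} later≡0))
        (ℤ.+-identityʳ (F i))
  where
  later : Fin i → ℤ
  later j = sgn (suc (toℕ j)) ℤ.* (ℤ.+ (0 C suc (toℕ j)) ℤ.* F (i ℕ.∸ suc (toℕ j)))
  later≡0 : ∀ j → later j ≡ ℤ.+ 0
  later≡0 j = ℤ.*-zeroʳ (sgn (suc (toℕ j)))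

-- Pascal's rule, C(a+1, j+1) = C(a, j) + C(a, j+1), regrouped under the sum.
mul[1-t]^-suc : ∀ a F i → mul[1-t]^ (suc a) F i ≡ Δ (mul[1-t]^ a F) i
mul[1-t]^-suc a F zero    = refl
mul[1-t]^-suc a F (suc i) = begin
  first ℤ.+ sumℤ {suc i} (λ j → sgn (suc (toℕ j)) ℤ.* (ℤ.+ (suc a C suc (toℕ j)) ℤ.* F (i ℕ.∸ toℕ j)))
    ≡⟨ cong (λ s → first ℤ.+ s) (sumℤ-cong {suc i} pascal) ⟩
  first ℤ.+ sumℤ {suc i} (λ j → next j ℤ.- this j)
    ≡⟨ cong (λ s → first ℤ.+ s) (sumℤ-minus next this) ⟩
  first ℤ.+ (sumℤ next ℤ.- sumℤ this)
    ≡⟨ reassoc first (sumℤ next) (sumℤ this) ⟩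
  mul[1-t]^ a F (suc i) ℤ.- mul[1-t]^ a F i ∎
  where
  open ≡-Reasoning
  open ℤ-Solver.+-*-Solver
  first : ℤ
  first = sgn 0 ℤ.* (ℤ.+ (a C 0) ℤ.* F (suc i))
  next this : Fin (suc i) → ℤ
  next j = sgn (suc (toℕ j)) ℤ.* (ℤ.+ (a C suc (toℕ j)) ℤ.* F (i ℕ.∸ toℕ j))
  this j = sgn (toℕ j) ℤ.* (ℤ.+ (a C toℕ j) ℤ.* F (i ℕ.∸ toℕ j))
  pascal : ∀ j →
    sgn (suc (toℕ j)) ℤ.* (ℤ.+ (suc a C suc (toℕ j)) ℤ.* F (i ℕ.∸ toℕ j)) ≡ next j ℤ.- this j
  pascal j = trans (cong (λ c → ℤ.- sgn (toℕ j) ℤ.* (c ℤ.* F (i ℕ.∸ toℕ j))) C-split)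
                   (split (sgn (toℕ j)) (ℤ.+ (a C toℕ j)) (ℤ.+ (a C suc (toℕ j))) (F (i ℕ.∸ toℕ j)))
    where
    C-split : ℤ.+ (suc a C suc (toℕ j)) ≡ ℤ.+ (a C toℕ j) ℤ.+ ℤ.+ (a C suc (toℕ j))
    C-split = trans (cong (λ k → ℤ.+ k) (sym (nCk+nC[k+1]≡[n+1]C[k+1] a (toℕ j))))
                    (ℤ.pos-+ (a C toℕ j) (a C suc (toℕ j)))
    split : ∀ s c c′ f → ℤ.- s ℤ.* ((c ℤ.+ c′) ℤ.* f) ≡ ℤ.- s ℤ.* (c′ ℤ.* f) ℤ.- s ℤ.* (c ℤ.* f)
    split = solve 4 (λ s c c′ f → :- s :* ((c :+ c′) :* f) := :- s :* (c′ :* f) :- s :* (c :* f)) refl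
  reassoc : ∀ h x y → h ℤ.+ (x ℤ.- y) ≡ (h ℤ.+ x) ℤ.- y
  reassoc = solve 3 (λ h x y → h :+ (x :- y) := (h :+ x) :- y) refl

mul[1-t]^-Δ : ∀ a F i → mul[1-t]^ a (Δ F) i ≡ Δ (mul[1-t]^ a F) i
mul[1-t]^-Δ zero    F i = trans (mul[1-t]^-zero (Δ F) i) (Δ-cong (λ k → sym (mul[1-t]^-zero F k)) i)
mul[1-t]^-Δ (suc a) F i = begin
  mul[1-t]^ (suc a) (Δ F) i ≡⟨ mul[1-t]^-suc a (Δ F) i ⟩
  Δ (mul[1-t]^ a (Δ F)) i   ≡⟨ Δ-cong (mul[1-t]^-Δ a F) i ⟩
  Δ (Δ (mul[1-t]^ a F)) i   ≡⟨ Δ-cong (λ k → sym (mul[1-t]^-suc a F k)) i ⟩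
  Δ (mul[1-t]^ (suc a) F) i ∎
  where open ≡-Reasoning

mul[1-t]^-one : ∀ a F → mul[1-t]^ a F 1 ≡ F 1 ℤ.- ℤ.+ (a C 1) ℤ.* F 0
mul[1-t]^-one a F = expand (F 1) (ℤ.+ (a C 1)) (F 0)
  where
  open ℤ-Solver.+-*-Solver
  expand : ∀ x c y →
    ℤ.+ 1 ℤ.* (ℤ.+ 1 ℤ.* x) ℤ.+ (ℤ.- ℤ.+ 1 ℤ.* (c ℤ.* y) ℤ.+ ℤ.+ 0) ≡ x ℤ.- c ℤ.* y
  expand = solve 3 (λ x c y → con (ℤ.+ 1) :* (con (ℤ.+ 1) :* x) :+ (:- con (ℤ.+ 1) :* (c :* y) :+ con (ℤ.+ 0))
                              := x :- c :* y) refl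

-- hstarCoeff hides its sign function in a where-clause; we recover it by unification: the
-- abstraction over toℕ j and ℤ.-_ turns the constraint on hstarSign into a pattern.
private
  hstarTerm : ℕ → (ℕ → ℕ) → ℕ → ℕ → ℤ
  hstarTerm d L i k = ℤ.+ ((suc d C k) ℕ.* L (i ℕ.∸ k))

  hstarCoeff-tail : ∀ d L i →
    Σ (Fin i → ℤ) λ g → hstarCoeff d L i ≡ ℤ.+ 1 ℤ.* hstarTerm d L i 0 ℤ.+ sumℤ g
  hstarCoeff-tail d L i = _ , refl

  mutual
    hstarSign : ℕ → (ℕ → ℕ) → ℕ → ℕ → ℤ
    hstarSign d L i = _

    hstarCoeff-tail≡ : ∀ d L i (j : Fin i) →
      proj₁ (hstarCoeff-tail d L i) j ≡ ℤ.- hstarSign d L i (toℕ j) ℤ.* hstarTerm d L i (suc (toℕ j))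
    hstarCoeff-tail≡ d L i j with toℕ j | ℤ.-_
    ... | _ | _ = refl

  hstarSign≡sgn : ∀ d L i k → hstarSign d L i k ≡ sgn k
  hstarSign≡sgn d L i zero    = refl
  hstarSign≡sgn d L i (suc k) = cong ℤ.-_ (hstarSign≡sgn d L i k)

hstarCoeff≡mul[1-t]^ : ∀ d L i → hstarCoeff d L i ≡ mul[1-t]^ (suc d) (λ k → ℤ.+ L k) i
hstarCoeff≡mul[1-t]^ d L i = trans (proj₂ (hstarCoeff-tail d L i)) (cong₂ ℤ._+_
  (cong (λ x → ℤ.+ 1 ℤ.* x) (ℤ.pos-* (suc d C 0) (L i)))
  (sumℤ-cong λ j → trans (hstarCoeff-tail≡ d L i j)
     (cong₂ (λ s x → ℤ.- s ℤ.* x) (hstarSign≡sgn d L i (toℕ j)) (ℤ.pos-* (suc d C suc (toℕ j)) _))))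

hstarCoeff-cong : ∀ d {L L′} → (∀ k → L k ≡ L′ k) → ∀ i → hstarCoeff d L i ≡ hstarCoeff d L′ i
hstarCoeff-cong d {L} {L′} L≗L′ i = begin
  hstarCoeff d L i                     ≡⟨ hstarCoeff≡mul[1-t]^ d L i ⟩
  mul[1-t]^ (suc d) (λ k → ℤ.+ L k) i  ≡⟨ mul[1-t]^-cong (suc d) (λ k → cong ℤ.+_ (L≗L′ k)) i ⟩
  mul[1-t]^ (suc d) (λ k → ℤ.+ L′ k) i ≡⟨ hstarCoeff≡mul[1-t]^ d L′ i ⟨
  hstarCoeff d L′ i                    ∎
  where open ≡-Reasoning

-- If L is the sequence of partial sums of L′ then (1 - t)^(d+2) L(t) = (1 - t)^(d+1) L′(t).
hstarCoeff-partialSums : ∀ d {L L′} → L 0 ≡ L′ 0 → (∀ k → L (suc k) ≡ L′ (suc k) ℕ.+ L k) →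
  ∀ i → hstarCoeff (suc d) L i ≡ hstarCoeff d L′ i
hstarCoeff-partialSums d {L} {L′} L₀≡ Lₛ≡ i = begin
  hstarCoeff (suc d) L i               ≡⟨ hstarCoeff≡mul[1-t]^ (suc d) L i ⟩
  mul[1-t]^ (suc (suc d)) L⁺ i         ≡⟨ mul[1-t]^-suc (suc d) L⁺ i ⟩
  Δ (mul[1-t]^ (suc d) L⁺) i           ≡⟨ mul[1-t]^-Δ (suc d) L⁺ i ⟨
  mul[1-t]^ (suc d) (Δ L⁺) i           ≡⟨ mul[1-t]^-cong (suc d) ΔL≡L′ i ⟩
  mul[1-t]^ (suc d) (λ k → ℤ.+ L′ k) i ≡⟨ hstarCoeff≡mul[1-t]^ d L′ i ⟨
  hstarCoeff d L′ i                    ∎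
  where
  open ≡-Reasoning
  L⁺ : ℕ → ℤ
  L⁺ k = ℤ.+ L k
  ΔL≡L′ : ∀ k → Δ L⁺ k ≡ ℤ.+ L′ k
  ΔL≡L′ zero    = cong ℤ.+_ L₀≡
  ΔL≡L′ (suc k) = begin
    ℤ.+ L (suc k) ℤ.- ℤ.+ L k              ≡⟨ cong (λ x → ℤ.+ x ℤ.- ℤ.+ L k) (Lₛ≡ k) ⟩
    ℤ.+ (L′ (suc k) ℕ.+ L k) ℤ.- ℤ.+ L k   ≡⟨ cong (ℤ._- ℤ.+ L k) (ℤ.pos-+ (L′ (suc k)) (L k)) ⟩
    ℤ.+ L′ (suc k) ℤ.+ ℤ.+ L k ℤ.- ℤ.+ L k ≡⟨ cancel (ℤ.+ L′ (suc k)) (ℤ.+ L k) ⟩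
    ℤ.+ L′ (suc k)                         ∎
    where
    open ℤ-Solver.+-*-Solver
    cancel : ∀ a b → a ℤ.+ b ℤ.- b ≡ a
    cancel = solve 2 (λ a b → a :+ b :- b := a) refl

hstarCoeff₁ : ∀ d L → hstarCoeff d L 1 ≡ ℤ.+ L 1 ℤ.- ℤ.+ (suc d C 1) ℤ.* ℤ.+ L 0
hstarCoeff₁ d L = trans (hstarCoeff≡mul[1-t]^ d L 1) (mul[1-t]^-one (suc d) (λ k → ℤ.+ L k))

hstarCoeff₁-injective : ∀ d {L L′} → L 0 ≡ L′ 0 → hstarCoeff d L 1 ≡ hstarCoeff d L′ 1 → L 1 ≡ L′ 1
hstarCoeff₁-injective d {L} {L′} L₀≡ h₁≡ = ℤ.+-injective (begin
  ℤ.+ L 1                   ≡⟨ shift (ℤ.+ L 1) c ⟩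
  ℤ.+ L 1 ℤ.- c ℤ.+ c       ≡⟨ cong (ℤ._+ c) (hstarCoeff₁ d L) ⟨
  hstarCoeff d L 1 ℤ.+ c    ≡⟨ cong (ℤ._+ c) h₁≡ ⟩
  hstarCoeff d L′ 1 ℤ.+ c   ≡⟨ cong (ℤ._+ c) (trans (hstarCoeff₁ d L′) L′₀≡) ⟩
  ℤ.+ L′ 1 ℤ.- c ℤ.+ c      ≡⟨ shift (ℤ.+ L′ 1) c ⟨
  ℤ.+ L′ 1                  ∎)
  where
  open ≡-Reasoning
  open ℤ-Solver.+-*-Solver
  c₁ = ℤ.+ (suc d C 1)
  c = c₁ ℤ.* ℤ.+ L 0
  L′₀≡ : ℤ.+ L′ 1 ℤ.- c₁ ℤ.* ℤ.+ L′ 0 ≡ ℤ.+ L′ 1 ℤ.- c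
  L′₀≡ = cong (λ z → ℤ.+ L′ 1 ℤ.- c₁ ℤ.* ℤ.+ z) (sym L₀≡)
  shift : ∀ a c → a ≡ a ℤ.- c ℤ.+ c
  shift = solve 2 (λ a c → a := a :- c :+ c) refl

-- Non-redundant edges

indicatorℤ : ∀ {n} → Fin n → Fin n → ℤ
indicatorℤ a v with a ≟ v
... | yes _ = ℤ.+ 1
... | no _  = ℤ.+ 0

toℚ-indicatorℤ : ∀ {n} (a v : Fin n) → toℚ (indicatorℤ a v) ≡ indicator a v
toℚ-indicatorℤ a v with a ≟ v
... | yes _ = refl
... | no _  = refl

xvecℤ : ∀ {n m} → Digraph n m → Fin m → Fin n → ℤ
xvecℤ G f v = indicatorℤ (head G f) v ℤ.- indicatorℤ (tail G f) v

toℚ-xvecℤ : ∀ {n m} (G : Digraph n m) f v → toℚ (xvecℤ G f v) ≡ xvec G f v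
toℚ-xvecℤ G f v = trans (toℚ-+ (indicatorℤ (head G f) v) (ℤ.- indicatorℤ (tail G f) v))
  (cong₂ _+_ (toℚ-indicatorℤ (head G f) v)
             (trans (toℚ-neg (indicatorℤ (tail G f) v)) (cong -_ (toℚ-indicatorℤ (tail G f) v))))

lincomb-difference : ∀ {n k} (a : Fin k → ℚ) (w : Fin k → Fin n → ℚ) u v →
  lincomb a w u - lincomb a w v ≡ sumℚ (λ j → a j * (w j u - w j v))
lincomb-difference a w u v = sym (trans (sumℚ-cong (λ j → distrib (a j) (w j u) (w j v)))
                                        (sumℚ-minus (λ j → a j * w j u) (λ j → a j * w j v)))
  where
  open +-*-Solver
  distrib : ∀ a x y → a * (x - y) ≡ a * x - a * y
  distrib = solve 3 (λ a x y → a :* (x :- y) := a :* x :- a :* y) refl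

sumℚ-weighted-≤ : ∀ {k} {μ y : Fin k → ℚ} → (∀ j → 0ℚ ≤ μ j) → (∀ j → y j ≤ 1ℚ) →
  sumℚ (λ j → μ j * y j) ≤ sumℚ μ
sumℚ-weighted-≤ {μ = μ} 0≤μ y≤1 =
  sumℚ-mono-≤ (λ j → ℚ.≤-trans (*-monoˡ-≤ (0≤μ j) (y≤1 j)) (ℚ.≤-reflexive (ℚ.*-identityʳ (μ j))))

xvec-gap : ∀ {n m} (G : Digraph n m) f {h t} → ¬ (tail G f ≡ t × head G f ≡ h) →
  xvec G f h - xvec G f t ≤ 1ℚ
xvec-gap G f {h} {t} not-t→h = begin
  (I (head G f) h - I (tail G f) h) - (I (head G f) t - I (tail G f) t)
    ≡⟨ regroup (I (head G f) h) (I (tail G f) h) (I (head G f) t) (I (tail G f) t) ⟩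
  (I (head G f) h + I (tail G f) t) - (I (tail G f) h + I (head G f) t)
    ≤⟨ x-nonNeg≤x (nonNeg+ (indicator-nonNeg (tail G f) h) (indicator-nonNeg (head G f) t)) ⟩
  I (head G f) h + I (tail G f) t
    ≤⟨ at-most-one ⟩
  1ℚ ∎
  where
  open ℚ.≤-Reasoning
  open +-*-Solver
  I = indicator
  regroup : ∀ a b c d → (a - b) - (c - d) ≡ (a + d) - (b + c)
  regroup = solve 4 (λ a b c d → (a :- b) :- (c :- d) := (a :+ d) :- (b :+ c)) refl
  at-most-one : I (head G f) h + I (tail G f) t ≤ 1ℚ
  at-most-one with head G f ≟ h | tail G f ≟ t
  ... | yes h≡ | yes t≡ = ⊥-elim (not-t→h (t≡ , h≡))
  ... | yes _  | no _   = ℚ.≤-refl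
  ... | no _   | yes _  = ℚ.≤-refl
  ... | no _   | no _   = 0≤1

xvec-gap-self : ∀ {n m} (G : Digraph n m) f → ¬ IsLoop G f →
  xvec G f (head G f) - xvec G f (tail G f) ≡ 1ℚ + 1ℚ
xvec-gap-self G f ¬loop rewrite indicator-same (head G f) | indicator-same (tail G f)
                              | indicator-other ¬loop | indicator-other (¬loop ∘ sym) = refl

¬loop⇒¬parallel⇒¬redundant : ∀ {n m} (D : Digraph n (suc m)) e → ¬ IsLoop D e → ¬ HasParallel D e →
  ¬ Redundant D e
¬loop⇒¬parallel⇒¬redundant D e ¬loop ¬parallel (μ , 0≤μ , Σμ≤1 , xₑ≡) = 2≰1 (begin
  1ℚ + 1ℚ
    ≡⟨ xvec-gap-self D e ¬loop ⟨
  xvec D e h - xvec D e t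
    ≡⟨ cong₂ _-_ (xₑ≡ h) (xₑ≡ t) ⟩
  lincomb μ (xvec D∖e) h - lincomb μ (xvec D∖e) t
    ≡⟨ lincomb-difference μ (xvec D∖e) h t ⟩
  sumℚ (λ g → μ g * (xvec D∖e g h - xvec D∖e g t))
    ≤⟨ sumℚ-weighted-≤ 0≤μ (λ g → xvec-gap D∖e g (not-parallel g)) ⟩
  sumℚ μ
    ≤⟨ Σμ≤1 ⟩
  1ℚ ∎)
  where
  open ℚ.≤-Reasoning
  D∖e = deleteEdge D e
  h = head D e
  t = tail D e
  not-parallel : ∀ g → ¬ (tail D∖e g ≡ t × head D∖e g ≡ h)
  not-parallel g (t≡ , h≡) = ¬parallel (punchIn e g , Fin.punchInᵢ≢i e g , t≡ , h≡)

module _ {n m : ℕ} (D : Digraph n (suc m)) (e : Fin (suc m)) where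

  private
    D∖e = deleteEdge D e

  module _ {d d′ : ℕ} (dim : IsDim D d) (dim′ : IsDim D∖e d′) where

    dim-deleteEdge-≤ : d′ ℕ.≤ d
    dim-deleteEdge-≤ = IsDim-mono {G = D∖e} {G′ = D} dim′ dim (InDilate-deleteEdge D e)

    dim-deleteEdge-≥ : InSpan (xvec D∖e) (xvec D e) → d ℕ.≤ d′
    dim-deleteEdge-≥ xₑ∈ = let ((ps , ps∈ , li) , _) = dim in
      IsDim-bound-InSpan {G = D∖e} dim′ ps
        (λ i → InSpan-trans generators∈ (InDilate⇒InSpan-deleteEdge D e (ps∈ i))) li
      where
      generators∈ : ∀ j → InSpan (xvec D∖e) ((xvec D e ∷ xvec D∖e) j)
      generators∈ zero    = xₑ∈
      generators∈ (suc j) = InSpan-basis j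

    dim-deleteEdge-≤suc : d ℕ.≤ suc d′
    dim-deleteEdge-≤suc = let ((ps , ps∈ , li) , _) = dim in ≤suc ps ps∈ li
      where
      ≤suc : ∀ {k} (ps : Fin k → Fin n → ℚ) → (∀ i → InDilate D 1ℚ (ps i)) → LinIndep ps → k ℕ.≤ suc d′
      ≤suc {zero}  _  _   _  = ℕ.z≤n
      ≤suc {suc k} ps ps∈ li =
        let (u , li-u , u∈) = eliminate (xvec D e) (xvec D∖e) ps li (InDilate⇒InSpan-deleteEdge D e ∘ ps∈)
        in ℕ.s≤s (IsDim-bound-InSpan {G = D∖e} dim′ u u∈ li-u)

  EhrhartCount-deleteEdge-0 : ∀ {L L′} → IsEhrhartCount D L → IsEhrhartCount D∖e L′ → L 0 ≡ L′ 0
  EhrhartCount-deleteEdge-0 count count′ = EhrhartCount-≡ {G = D} {G′ = D∖e} count count′ 0 λ p →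
    mk⇔ (λ p∈@(μ , 0≤μ , Σμ≤0 , _) →
           InDilate-unused D e p∈ (ℚ.≤-antisym (ℚ.≤-trans (term≤sumℚ 0≤μ e) Σμ≤0) (0≤μ e)))
        (InDilate-deleteEdge D e)

  module _ {d d′ : ℕ} {L L′ : ℕ → ℕ} (dim : IsDim D d) (count : IsEhrhartCount D L)
           (dim′ : IsDim D∖e d′) (count′ : IsEhrhartCount D∖e L′) where

    hstarCoeff-redundant : Redundant D e → ∀ i → hstarCoeff d L i ≡ hstarCoeff d′ L′ i
    hstarCoeff-redundant xₑ∈ i = trans (cong (λ d → hstarCoeff d L i) d≡d′) (hstarCoeff-cong d′ L≗L′ i)
      where
      same : ∀ {t q} → InDilate D t q ⇔ InDilate D∖e t q
      same = mk⇔ (InDilate-redundant D e xₑ∈) (InDilate-deleteEdge D e)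
      d≡d′ : d ≡ d′
      d≡d′ = ℕ.≤-antisym (IsDim-mono {G = D} {G′ = D∖e} dim dim′ (Equivalence.to same))
                         (dim-deleteEdge-≤ dim dim′)
      L≗L′ : ∀ k → L k ≡ L′ k
      L≗L′ k = EhrhartCount-≡ {G = D} {G′ = D∖e} count count′ k (λ p → same)

    hstarCoeff₁-nonBridge : ¬ IsLoop D e → ¬ HasParallel D e → WeaklyConnected D∖e →
      hstarCoeff d L 1 ≢ hstarCoeff d′ L′ 1
    hstarCoeff₁-nonBridge ¬loop ¬parallel connected′ h₁≡ = ℕ.<-irrefl (sym L₁≡) L′₁<L₁
      where
      d≡d′ : d ≡ d′
      d≡d′ = ℕ.≤-antisym (dim-deleteEdge-≥ dim dim′ (Reach⇒InSpan (connected′ (tail D e) (head D e))))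
                         (dim-deleteEdge-≤ dim dim′)
      L₁≡ : L 1 ≡ L′ 1
      L₁≡ = hstarCoeff₁-injective d {L} {L′} (EhrhartCount-deleteEdge-0 count count′)
                                  (trans h₁≡ (cong (λ d → hstarCoeff d L′ 1) (sym d≡d′)))
      xₑ : Vec ℤ n
      xₑ = tabulate (xvecℤ D e)
      toℚ-xₑ : ∀ v → xvec D e v ≡ toℚ (lookup xₑ v)
      toℚ-xₑ v = sym (trans (cong toℚ (Vec.lookup∘tabulate (xvecℤ D e) v)) (toℚ-xvecℤ D e v))
      L′₁<L₁ : L′ 1 ℕ.< L 1
      L′₁<L₁ = EhrhartCount-< {G = D∖e} {G′ = D} count′ count 1 {xₑ} (InDilate-deleteEdge D e)
        (InDilate-resp D toℚ-xₑ (InDilate-edge D e))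
        (¬loop⇒¬parallel⇒¬redundant D e ¬loop ¬parallel ∘ InDilate-resp D∖e (sym ∘ toℚ-xₑ))

-- Bridges

Vec-ext : ∀ {n} {A : Set} {p p′ : Vec A n} → (∀ v → lookup p v ≡ lookup p′ v) → p ≡ p′
Vec-ext {p = p} {p′} p≗p′ =
  trans (sym (Vec.tabulate∘lookup p)) (trans (Vec.tabulate-cong p≗p′) (Vec.tabulate∘lookup p′))

module Bridge {n m : ℕ} (D : Digraph n (suc m)) (e : Fin (suc m))
              (separated : ¬ Reach (deleteEdge D e) (tail D e) (head D e))
              (reachable? : ∀ v → Dec (Reach (deleteEdge D e) (tail D e) v)) where

  private
    D∖e = deleteEdge D e

  farSide : Fin n → ℤ
  farSide v with reachable? v
  ... | yes _ = ℤ.+ 0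
  ... | no _  = ℤ.+ 1

  weight : Fin n → ℚ
  weight v = toℚ (farSide v)

  φ : (Fin n → ℚ) → ℚ
  φ q = ⟪ weight , q ⟫

  φ-xvec-deleteEdge : ∀ g → φ (xvec D∖e g) ≡ 0ℚ
  φ-xvec-deleteEdge g = trans (pairing-xvec weight D∖e g)
    (trans (cong (λ z → toℚ z - toℚ (farSide (tail D∖e g))) same-side) (ℚ.+-inverseʳ (weight (tail D∖e g))))
    where
    same-side : farSide (head D∖e g) ≡ farSide (tail D∖e g)
    same-side with reachable? (head D∖e g) | reachable? (tail D∖e g)
    ... | yes _ | yes _ = refl
    ... | no _  | no _  = refl
    ... | yes r | no ¬r = ⊥-elim (¬r (bwd g r))
    ... | no ¬r | yes r = ⊥-elim (¬r (fwd g r))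

  φ-xvec-e : φ (xvec D e) ≡ 1ℚ
  φ-xvec-e = trans (pairing-xvec weight D e) (cong₂ (λ a b → toℚ a - toℚ b) far-head near-tail)
    where
    far-head : farSide (head D e) ≡ ℤ.+ 1
    far-head with reachable? (head D e)
    ... | yes r = ⊥-elim (separated r)
    ... | no _  = refl
    near-tail : farSide (tail D e) ≡ ℤ.+ 0
    near-tail with reachable? (tail D e)
    ... | yes _ = refl
    ... | no ¬r = ⊥-elim (¬r here)

  φ-InSpan : ∀ {r} {w : Fin r → Fin n → ℚ} → (∀ j → φ (w j) ≡ 0ℚ) → ∀ {q} → InSpan w q → φ q ≡ 0ℚ
  φ-InSpan {w = w} φw≡0 (a , q≡) = trans (pairing-resp weight q≡) (trans (pairing-lincomb weight a w)
    (sumℚ-zero (λ j → trans (cong (a j *_) (φw≡0 j)) (ℚ.*-zeroʳ (a j)))))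

  φ-InDilate-deleteEdge : ∀ {t q} → InDilate D∖e t q → φ q ≡ 0ℚ
  φ-InDilate-deleteEdge = φ-InSpan φ-xvec-deleteEdge ∘ InDilate⇒InSpan D∖e

  φ-InDilate : ∀ {t q} ((μ , _) : InDilate D t q) → φ q ≡ μ e
  φ-InDilate {q = q} (μ , _ , _ , q≡) = begin
    φ q                             ≡⟨ pairing-resp weight q≡ ⟩
    φ (lincomb μ (xvec D))          ≡⟨ pairing-lincomb weight μ (xvec D) ⟩
    sumℚ (λ f → μ f * φ (xvec D f)) ≡⟨ sumℚ-punchIn e (λ f → μ f * φ (xvec D f)) ⟩
    μ e * φ (xvec D e) + sumℚ (λ g → μ (punchIn e g) * φ (xvec D∖e g))
      ≡⟨ cong₂ _+_ (cong (μ e *_) φ-xvec-e)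
                   (sumℚ-zero (λ g → trans (cong (μ (punchIn e g) *_) (φ-xvec-deleteEdge g))
                                           (ℚ.*-zeroʳ (μ (punchIn e g))))) ⟩
    μ e * 1ℚ + 0ℚ ≡⟨ ℚ.+-identityʳ (μ e * 1ℚ) ⟩
    μ e * 1ℚ      ≡⟨ ℚ.*-identityʳ (μ e) ⟩
    μ e           ∎
    where open ≡-Reasoning

  LatticeIn-weight : ∀ {k p} ((μ , _) : LatticeIn D k p) → μ e ≡ 0ℚ ⊎ 1ℚ ≤ μ e
  LatticeIn-weight {p = p} p∈@(μ , 0≤μ , _) =
    Sum.map (trans μₑ≡z) (subst (1ℚ ≤_) (sym μₑ≡z)) (toℚ-nonNeg⇒0∨≥1 z (subst (0ℚ ≤_) μₑ≡z (0≤μ e)))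
    where
    z : ℤ
    z = sumℤ (λ v → farSide v ℤ.* lookup p v)
    μₑ≡z : μ e ≡ toℚ z
    μₑ≡z = trans (sym (φ-InDilate p∈))
                 (trans (sumℚ-cong (λ v → sym (toℚ-* (farSide v) (lookup p v))))
                        (sumℚ-toℚ (λ v → farSide v ℤ.* lookup p v)))

  dim-bridge : ∀ {d d′} → IsDim D d → IsDim D∖e d′ → d ≡ suc d′
  dim-bridge {d} {d′} dim dim′@((ps′ , ps′∈ , li′) , _) = ℕ.≤-antisym
    (dim-deleteEdge-≤suc D e dim dim′)
    (IsDim-bound {G = D} dim (xvec D e ∷ ps′) points (LinIndep-∷ xₑ∉ li′))
    where
    points : ∀ i → InDilate D 1ℚ ((xvec D e ∷ ps′) i)
    points zero    = InDilate-edge D e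
    points (suc j) = InDilate-deleteEdge D e (ps′∈ j)
    xₑ∉ : ¬ InSpan ps′ (xvec D e)
    xₑ∉ xₑ∈ = ℚ.1≢0 (trans (sym φ-xvec-e) (φ-InSpan (φ-InDilate-deleteEdge ∘ ps′∈) xₑ∈))

  shift unshift : Vec ℤ n → Vec ℤ n
  shift   p = tabulate (λ v → lookup p v ℤ.+ xvecℤ D e v)
  unshift p = tabulate (λ v → lookup p v ℤ.- xvecℤ D e v)

  shift-unshift : ∀ p → shift (unshift p) ≡ p
  shift-unshift p = Vec-ext λ v → begin
    lookup (shift (unshift p)) v                ≡⟨ Vec.lookup∘tabulate _ v ⟩
    lookup (unshift p) v ℤ.+ xvecℤ D e v        ≡⟨ cong (ℤ._+ xvecℤ D e v) (Vec.lookup∘tabulate _ v) ⟩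
    lookup p v ℤ.- xvecℤ D e v ℤ.+ xvecℤ D e v  ≡⟨ cancel (lookup p v) (xvecℤ D e v) ⟩
    lookup p v                                  ∎
    where
    open ≡-Reasoning
    open ℤ-Solver.+-*-Solver
    cancel : ∀ a x → a ℤ.- x ℤ.+ x ≡ a
    cancel = solve 2 (λ a x → a :- x :+ x := a) refl

  shift-injective : ∀ {p p′} → shift p ≡ shift p′ → p ≡ p′
  shift-injective {p} {p′} eq = Vec-ext λ v → begin
    lookup p v                                  ≡⟨ cancel (lookup p v) (xvecℤ D e v) ⟩
    lookup p v ℤ.+ xvecℤ D e v ℤ.- xvecℤ D e v  ≡⟨ cong (ℤ._- xvecℤ D e v) (Vec.lookup∘tabulate _ v) ⟨
    lookup (shift p) v ℤ.- xvecℤ D e v          ≡⟨ cong (λ p → lookup p v ℤ.- xvecℤ D e v) eq ⟩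
    lookup (shift p′) v ℤ.- xvecℤ D e v         ≡⟨ cong (ℤ._- xvecℤ D e v) (Vec.lookup∘tabulate _ v) ⟩
    lookup p′ v ℤ.+ xvecℤ D e v ℤ.- xvecℤ D e v ≡⟨ cancel (lookup p′ v) (xvecℤ D e v) ⟨
    lookup p′ v                                 ∎
    where
    open ≡-Reasoning
    open ℤ-Solver.+-*-Solver
    cancel : ∀ a x → a ≡ a ℤ.+ x ℤ.- x
    cancel = solve 2 (λ a x → a := a :+ x :- x) refl

  toℚ-shift : ∀ q v → toℚ (lookup (shift q) v) ≡ toℚ (lookup q v) + xvec D e v
  toℚ-shift q v = begin
    toℚ (lookup (shift q) v)             ≡⟨ cong toℚ (Vec.lookup∘tabulate _ v) ⟩
    toℚ (lookup q v ℤ.+ xvecℤ D e v)     ≡⟨ toℚ-+ (lookup q v) (xvecℤ D e v) ⟩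
    toℚ (lookup q v) + toℚ (xvecℤ D e v) ≡⟨ cong (toℚ (lookup q v) +_) (toℚ-xvecℤ D e v) ⟩
    toℚ (lookup q v) + xvec D e v        ∎
    where open ≡-Reasoning

  φ-shift : ∀ q → φ (λ v → toℚ (lookup (shift q) v)) ≡ φ (λ v → toℚ (lookup q v)) + 1ℚ
  φ-shift q = trans (pairing-resp weight (toℚ-shift q))
                    (trans (pairing-+ weight (λ v → toℚ (lookup q v)) (xvec D e))
                           (cong (φ (λ v → toℚ (lookup q v)) +_) φ-xvec-e))

  shift∈ : ∀ {k q} → LatticeIn D k q → LatticeIn D (suc k) (shift q)
  shift∈ {k} {q} q∈@(μ , 0≤μ , _) =
    subst (λ t → InDilate D t _) (sym (toℚ-suc k))
      (InDilate-resp D toℚ-shift′ (InDilate-shift D e q∈ 1ℚ (ℚ.+-mono-≤ (0≤μ e) 0≤1)))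
    where
    toℚ-shift′ : ∀ v → toℚ (lookup q v) + 1ℚ * xvec D e v ≡ toℚ (lookup (shift q) v)
    toℚ-shift′ v = trans (cong (toℚ (lookup q v) +_) (ℚ.*-identityˡ (xvec D e v))) (sym (toℚ-shift q v))

  unshift∈ : ∀ {k p} ((μ , _) : LatticeIn D (suc k) p) → 1ℚ ≤ μ e → LatticeIn D k (unshift p)
  unshift∈ {k} {p} p∈ 1≤μₑ =
    subst (λ t → InDilate D t _) level
      (InDilate-resp D toℚ-unshift (InDilate-shift D e p∈ (- 1ℚ) (≤⇒0≤- 1≤μₑ)))
    where
    open ≡-Reasoning
    open +-*-Solver
    level : toℚ (ℤ.+ suc k) + - 1ℚ ≡ toℚ (ℤ.+ k)
    level = trans (cong (_+ - 1ℚ) (toℚ-suc k)) (cancel (toℚ (ℤ.+ k)))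
      where
      cancel : ∀ x → x + 1ℚ + - 1ℚ ≡ x
      cancel = solve 1 (λ x → x :+ con 1ℚ :+ :- con 1ℚ := x) refl
    toℚ-unshift : ∀ v → toℚ (lookup p v) + - 1ℚ * xvec D e v ≡ toℚ (lookup (unshift p) v)
    toℚ-unshift v = sym (begin
      toℚ (lookup (unshift p) v)               ≡⟨ cong toℚ (Vec.lookup∘tabulate _ v) ⟩
      toℚ (lookup p v ℤ.+ ℤ.- xvecℤ D e v)     ≡⟨ toℚ-+ (lookup p v) (ℤ.- xvecℤ D e v) ⟩
      toℚ (lookup p v) + toℚ (ℤ.- xvecℤ D e v) ≡⟨ cong (toℚ (lookup p v) +_) (toℚ-neg (xvecℤ D e v)) ⟩
      toℚ (lookup p v) + - toℚ (xvecℤ D e v)   ≡⟨ cong (λ x → toℚ (lookup p v) + - x) (toℚ-xvecℤ D e v) ⟩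
      toℚ (lookup p v) + - xvec D e v          ≡⟨ cong (toℚ (lookup p v) +_) (neg≡-1* (xvec D e v)) ⟩
      toℚ (lookup p v) + - 1ℚ * xvec D e v     ∎)
      where
      neg≡-1* : ∀ x → - x ≡ - 1ℚ * x
      neg≡-1* = solve 1 (λ x → :- x := :- con 1ℚ :* x) refl

  LatticeIn-classify : ∀ {k p} → LatticeIn D (suc k) p →
    LatticeIn D∖e (suc k) p ⊎ LatticeIn D k (unshift p)
  LatticeIn-classify {k} {p} p∈ = Sum.map (InDilate-unused D e {toℚ (ℤ.+ suc k)} p∈) (unshift∈ {k} {p} p∈)
                                          (LatticeIn-weight {suc k} {p} p∈)

  EhrhartCount-bridge : ∀ {L L′} → IsEhrhartCount D L → IsEhrhartCount D∖e L′ →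
    ∀ k → L (suc k) ≡ L′ (suc k) ℕ.+ L k
  EhrhartCount-bridge {L} {L′} count count′ k with count (suc k) | count′ (suc k) | count k
  ... | ps , u , ∈ps , |ps|≡ | ps′ , u′ , ∈ps′ , |ps′|≡ | qs , uq , ∈qs , |qs|≡ = begin
    L (suc k)
      ≡⟨ sym |ps|≡ ⟩
    length ps
      ≡⟨ Unique-length-≡ u (Unique.++⁺ u′ (Unique.map⁺ shift-injective uq) disjoint) (mk⇔ split unsplit) ⟩
    length (ps′ ++ map shift qs)
      ≡⟨ length-++ ps′ ⟩
    length ps′ ℕ.+ length (map shift qs)
      ≡⟨ cong₂ ℕ._+_ |ps′|≡ (trans (length-map shift qs) |qs|≡) ⟩
    L′ (suc k) ℕ.+ L k ∎
    where
    open ≡-Reasoning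
    open Equivalence
    disjoint : Disjoint ps′ (map shift qs)
    disjoint (p∈ps′ , p∈shifted) with ∈-map⁻ shift p∈shifted
    ... | q , q∈qs , refl with to (∈qs q) q∈qs
    ...   | q∈@(μ , 0≤μ , _) = 1≰0 (subst (1ℚ ≤_) μₑ+1≡0 (ℚ.+-monoˡ-≤ 1ℚ (0≤μ e)))
      where
      μₑ+1≡0 : μ e + 1ℚ ≡ 0ℚ
      μₑ+1≡0 = trans (cong (_+ 1ℚ) (sym (φ-InDilate {toℚ (ℤ.+ k)} q∈)))
                     (trans (sym (φ-shift q))
                            (φ-InDilate-deleteEdge {toℚ (ℤ.+ suc k)} (to (∈ps′ (shift q)) p∈ps′)))
    split : ∀ {p} → p ∈ ps → p ∈ ps′ ++ map shift qs
    split {p} p∈ps = Sum.[ (λ p∈′ → ∈-++⁺ˡ (from (∈ps′ p) p∈′))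
                         , (λ p-xₑ∈ → ∈-++⁺ʳ ps′ (subst (_∈ map shift qs) (shift-unshift p)
                                                        (∈-map⁺ shift (from (∈qs (unshift p)) p-xₑ∈))))
                         ] (LatticeIn-classify {k} {p} (to (∈ps p) p∈ps))
    unsplit : ∀ {p} → p ∈ ps′ ++ map shift qs → p ∈ ps
    unsplit {p} p∈ with ∈-++⁻ ps′ p∈
    ... | inj₁ p∈ps′ = from (∈ps p) (InDilate-deleteEdge D e {toℚ (ℤ.+ suc k)} (to (∈ps′ p) p∈ps′))
    ... | inj₂ p∈shifted with ∈-map⁻ shift p∈shifted
    ...   | q , q∈qs , refl = from (∈ps (shift q)) (shift∈ {k} {q} (to (∈qs q) q∈qs))

  hstarCoeff-≡ : ∀ {d d′ L L′} → IsDim D d → IsEhrhartCount D L → IsDim D∖e d′ → IsEhrhartCount D∖e L′ →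
    ∀ i → hstarCoeff d L i ≡ hstarCoeff d′ L′ i
  hstarCoeff-≡ {d′ = d′} {L} {L′} dim count dim′ count′ i =
    trans (cong (λ d → hstarCoeff d L i) (dim-bridge dim dim′))
          (hstarCoeff-partialSums d′ {L} {L′} (EhrhartCount-deleteEdge-0 D e count count′)
                                  (EhrhartCount-bridge count count′) i)

¬¬-Dec-all : ∀ {n} (P : Fin n → Set) → ¬ ¬ (∀ v → Dec (P v))
¬¬-Dec-all {zero}  P = return (λ ())
¬¬-Dec-all {suc n} P = ¬¬-excluded-middle >>= λ P₀? →
  (λ P? → Fin.∀-cons P₀? P?) <$> ¬¬-Dec-all (P ∘ suc)

hstarCoeff-bridge : ∀ {n m} (D : Digraph n (suc m)) e → WeaklyConnected D → IsBridge D e →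
  ∀ {d d′ L L′} → IsDim D d → IsEhrhartCount D L →
  IsDim (deleteEdge D e) d′ → IsEhrhartCount (deleteEdge D e) L′ →
  ∀ i → hstarCoeff d L i ≡ hstarCoeff d′ L′ i
hstarCoeff-bridge D e connected bridge {d} {d′} {L} {L′} dim count dim′ count′ i =
  decidable-stable (hstarCoeff d L i ℤ.≟ hstarCoeff d′ L′ i)
    ((λ reachable? → Bridge.hstarCoeff-≡ D e (bridge⇒separates D e connected bridge) reachable?
                                         dim count dim′ count′ i)
     <$> ¬¬-Dec-all _)

HasParallel? : ∀ {n m} (D : Digraph n m) e → Dec (HasParallel D e)
HasParallel? D e = Fin.any? (λ f → ¬? (f ≟ e) ×-dec (tail D f ≟ tail D e) ×-dec (head D f ≟ head D e))

proposition1p4 : ∀ {n m} (D : Digraph n (suc m)) (e : Fin (suc m)) →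
    WeaklyConnected D →
    ∀ (d d' : ℕ) (L L' : ℕ → ℕ) →
    IsDim D d → IsEhrhartCount D L →
    IsDim (deleteEdge D e) d' → IsEhrhartCount (deleteEdge D e) L' →
    ((∀ i → hstarCoeff d L i ≡ hstarCoeff d' L' i) ⇔
      (IsLoop D e ⊎ IsBridge D e ⊎ HasParallel D e))
proposition1p4 D e connected d d′ L L′ dim count dim′ count′ = mk⇔ classify hstar-equal
  where
  hstar-equal : IsLoop D e ⊎ IsBridge D e ⊎ HasParallel D e → ∀ i → hstarCoeff d L i ≡ hstarCoeff d′ L′ i
  hstar-equal (inj₁ loop)            = hstarCoeff-redundant D e dim count dim′ count′ (loop⇒redundant D e loop)
  hstar-equal (inj₂ (inj₁ bridge))   = hstarCoeff-bridge D e connected bridge dim count dim′ count′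
  hstar-equal (inj₂ (inj₂ parallel)) =
    hstarCoeff-redundant D e dim count dim′ count′ (parallel⇒redundant D e parallel)
  classify : (∀ i → hstarCoeff d L i ≡ hstarCoeff d′ L′ i) → IsLoop D e ⊎ IsBridge D e ⊎ HasParallel D e
  classify h≡ with tail D e ≟ head D e | HasParallel? D e
  ... | yes loop | _             = inj₁ loop
  ... | no _     | yes parallel  = inj₂ (inj₂ parallel)
  ... | no ¬loop | no ¬parallel  = inj₂ (inj₁ λ connected′ →
    hstarCoeff₁-nonBridge D e dim count dim′ count′ ¬loop ¬parallel connected′ (h≡ 1))
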